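{- The map $\beta\mapsto(\dot T,\dot U)$ (dotted Robinson–Schensted–Knuth) is a bijection between biwords over $A$ and pairs of dotted semistandard Young tableaux of the same shape, and it satisfies $\vec m(\beta)=(\vec m(\dot T),\vec m(\dot U))$.
   Context: Fix $n\ge1$ and let $A=\{i^{(k)}:i\ge1,\ 1\le k\le n\}$ ($i^{(k)}$ is the integer $i$ carrying $k$ dots), partially ordered by $i^{(k)}<j^{(l)}$ iff $i<j$. A dotted semistandard Young tableau is a filling of a Young diagram with elements of $A$ whose rows weakly increase and columns strictly increase in this order. A biword of length $N$ over $A$ is a $2\times N$ array of elements of $A$ such that, after removing dots, the columns are in weakly increasing lexicographic order with the top row taking precedence. The multidegree $\vec m(M)=[m_1,\dots,m_n]$ of a multiset $M$ of elements of $A$ records the number $m_k$ of elements with $k$ dots; for a biword $\beta$ with lower row $\check\beta$ and upper row $\hat\beta$, $\vec m(\beta)=(\vec m(\check\beta),\vec m(\hat\beta))$, and for a tableau the multidegree is that of its multiset of entries. The map sends $\beta$ to $(\dot T,\dot U)$ obtained by performing the ordinary RSK algorithm on $\beta$, comparing entries only through their underlying integers (the dots being carried along with the entries): reading columns left to right, the bottom entry is row-inserted into $\dot T$ (an inserted entry bumps the leftmost entry of the row whose integer is strictly larger, and the bumped entry is inserted into the next row), and the top entry is placed in $\dot U$ in the cell created by that insertion. -}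

module Defs where

open import Data.Nat using (ℕ; zero; suc; _+_; _≤_; _<_; _<ᵇ_)
open import Data.Fin using (Fin)
open import Data.Fin.Properties using () renaming (_≟_ to _≟ᶠ_)
open import Data.Bool using (Bool; true; false)
open import Data.List using (List; []; _∷_; map; concat; length)
open import Data.List.Relation.Unary.Linked using (Linked)
open import Data.List.Relation.Unary.All using (All)
open import Data.Vec using (Vec; tabulate)
open import Data.Product using (_×_; _,_; proj₁; proj₂)
open import Data.Sum using (_⊎_)
open import Data.Unit using (⊤)
open import Data.Empty using (⊥)
open import Relation.Binary.PropositionalEquality using (_≡_)
open import Relation.Nullary using (yes; no)

-- An element i^(k) of the alphabet A (for fixed n).
-- int  : the underlying integer, encoded 0-based: int = i - 1 (i ≥ 1).
-- dots : number of dots, encoded 0-based: dots = k - 1 (1 ≤ k ≤ n).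
record Letter (n : ℕ) : Set where
  constructor _^_
  field
    int  : ℕ
    dots : Fin n
open Letter public

_≺_ : ∀ {n} → Letter n → Letter n → Set
a ≺ b = int a < int b

-- "a ≤ b" in the sense of rows weakly increasing: not (b < a), i.e. int a ≤ int b.
_≼_ : ∀ {n} → Letter n → Letter n → Set
a ≼ b = int a ≤ int b

-- Dotted tableaux: a list of rows (top row first), each a list of letters.

Row : ℕ → Set
Row n = List (Letter n)

Tableau : ℕ → Set
Tableau n = List (Row n)

shape : ∀ {n} → Tableau n → List ℕ
shape = map length

NonEmpty : ∀ {n} → Row n → Set
NonEmpty []      = ⊥
NonEmpty (_ ∷ _) = ⊤

ColBelow : ∀ {n} → Row n → Row n → Set
ColBelow _        []       = ⊤
ColBelow []       (_ ∷ _)  = ⊥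
ColBelow (a ∷ as) (b ∷ bs) = (a ≺ b) × ColBelow as bs

-- Dotted semistandard Young tableau: rows nonempty (Young diagram, with the
-- length condition contained in ColBelow), rows weakly increasing,
-- columns strictly increasing.
IsDottedSSYT : ∀ {n} → Tableau n → Set
IsDottedSSYT T = All NonEmpty T × All (Linked _≼_) T × Linked ColBelow T

-- Biwords: a list of columns (top , bottom), read left to right.

Biword : ℕ → Set
Biword n = List (Letter n × Letter n)

LexLe : ∀ {n} → Letter n × Letter n → Letter n × Letter n → Set
LexLe (a , b) (c , d) = (int a < int c) ⊎ ((int a ≡ int c) × (int b ≤ int d))

IsBiword : ∀ {n} → Biword n → Set
IsBiword β = Linked LexLe β

upper : ∀ {n} → Biword n → List (Letter n)
upper = map proj₁

lower : ∀ {n} → Biword n → List (Letter n)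
lower = map proj₂

countDots : ∀ {n} → Fin n → List (Letter n) → ℕ
countDots k [] = 0
countDots k (a ∷ as) with dots a ≟ᶠ k
... | yes _ = suc (countDots k as)
... | no  _ = countDots k as

mdeg : ∀ {n} → List (Letter n) → Vec ℕ n
mdeg xs = tabulate (λ k → countDots k xs)

mdegBiword : ∀ {n} → Biword n → Vec ℕ n × Vec ℕ n
mdegBiword β = mdeg (lower β) , mdeg (upper β)

mdegTableau : ∀ {n} → Tableau n → Vec ℕ n
mdegTableau T = mdeg (concat T)

data Bump (n : ℕ) : Set where
  appended : Row n → Bump n
  bumped   : Row n → Letter n → Bump n

rowInsert : ∀ {n} → Letter n → Row n → Bump n
rowInsert x [] = appended (x ∷ [])
rowInsert x (y ∷ ys) with int x <ᵇ int y
... | true  = bumped (x ∷ ys) y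
... | false with rowInsert x ys
...   | appended ys'   = appended (y ∷ ys')
...   | bumped ys' z   = bumped (y ∷ ys') z

-- Row-insert x into a tableau; returns the new tableau and the index of the
-- row in which a new cell was created.
insert : ∀ {n} → Letter n → Tableau n → Tableau n × ℕ
insert x [] = (x ∷ []) ∷ [] , 0
insert x (r ∷ rs) with rowInsert x r
... | appended r'  = r' ∷ rs , 0
... | bumped r' z with insert z rs
...   | rs' , i = r' ∷ rs' , suc i

placeAt : ∀ {n} → ℕ → Letter n → Tableau n → Tableau n
placeAt _       y []       = (y ∷ []) ∷ []
placeAt zero    y (r ∷ rs) = (r Data.List.++ (y ∷ [])) ∷ rs
placeAt (suc i) y (r ∷ rs) = r ∷ placeAt i y rs

rskFrom : ∀ {n} → Tableau n → Tableau n → Biword n → Tableau n × Tableau n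
rskFrom T U [] = T , U
rskFrom T U ((t , b) ∷ β) with insert b T
... | T' , i = rskFrom T' (placeAt i t U) β

dottedRSK : ∀ {n} → Biword n → Tableau n × Tableau n
dottedRSK = rskFrom [] []

-- Dotted RSK is ordinary RSK on the underlying integers with the dots carried along, so the
-- classical argument applies. Read the biword column by column. Row insertion keeps the insertion
-- tableau semistandard, and by the row bumping lemma, when two consecutive columns have the same
-- top letter the second new cell lies strictly right of and weakly above the first. Hence the top
-- letter t placed in the recording tableau is a largest entry of it and exceeds every entry in the
-- rows above its cell, so the recording tableau stays semistandard of the same shape. This also
-- makes each step invertible: the highest cell holding a largest entry of the recording tableau is
-- a corner; removing it and reverse-bumping out of the same corner of the insertion tableau
-- recovers the previous pair and the last column, and the bumping lemma shows that the columns
-- recovered this way are in lexicographic order. Insertion and placement only permute letters, so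
-- the multidegrees agree.

module Submission where

open import Defs
open import Data.Nat using (ℕ; _≤_)
open import Data.Product using (_×_; _,_; Σ; proj₁; proj₂)
open import Relation.Binary.PropositionalEquality using (_≡_)

open import Data.Bool using (true; false) renaming (T to True)
open import Data.Empty using (⊥; ⊥-elim)
open import Data.Fin using (Fin)
open import Data.Fin.Properties using () renaming (_≟_ to _≟ᶠ_)
open import Data.List using (List; []; _∷_; _++_; _∷ʳ_; length; concat)
open import Data.List.Properties using (length-++; map-++; length-map)
open import Data.List.Relation.Binary.Permutation.Propositional using (_↭_; ↭-sym; module PermutationReasoning)
import Data.List.Relation.Binary.Permutation.Propositional as ↭
open import Data.List.Relation.Binary.Permutation.Propositional.Properties using (∷↭∷ʳ; shift)
  renaming (++⁺ʳ to ++⁺ʳ↭; ++⁺ˡ to ++⁺ˡ↭)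
open import Data.List.Relation.Binary.Pointwise using (Pointwise; []; _∷_; Pointwise-length)
import Data.List.Relation.Binary.Pointwise as Pointwise
open import Data.List.Relation.Unary.All using (All; []; _∷_; lookupAny)
import Data.List.Relation.Unary.All as All
open import Data.List.Relation.Unary.All.Properties using (∷ʳ⁺; ∷ʳ⁻)
open import Data.List.Relation.Unary.Any using (Any; here; there)
open import Data.List.Relation.Unary.Any.Properties using (++⁺ʳ)
open import Data.List.Relation.Unary.Linked using (Linked; []; [-]; _∷_)
import Data.List.Relation.Unary.Linked as Linked
open import Data.List.Relation.Unary.Linked.Properties using (Linked⇒All)
open import Data.List.Reverse using (Reverse; reverseView; []; _∶_∶ʳ_)
open import Data.Nat using (zero; suc; _+_; _<_; _<ᵇ_; z≤n; s≤s)
open import Data.Nat.ListAction using (sum)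
open import Data.Nat.Properties
open import Algebra.Properties.CommutativeSemigroup +-commutativeSemigroup using (x∙yz≈y∙xz)
open import Data.Sum using (_⊎_; inj₁; inj₂)
open import Data.Unit using (⊤; tt)
open import Data.Vec.Properties using (tabulate-cong)
open import Relation.Binary.Definitions using (tri<; tri≈; tri>)
open import Relation.Binary.PropositionalEquality using (refl; sym; trans; cong; cong₂; subst; module ≡-Reasoning)
open import Relation.Nullary using (yes; no; ¬_)

<ᵇ≡true⇒< : ∀ {m k} → (m <ᵇ k) ≡ true → m < k
<ᵇ≡true⇒< {m} {k} eq = <ᵇ⇒< m k (subst True (sym eq) tt)

<ᵇ≡false⇒≥ : ∀ {m k} → (m <ᵇ k) ≡ false → k ≤ m
<ᵇ≡false⇒≥ eq = ≮⇒≥ (λ lt → subst True eq (<⇒<ᵇ lt))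

<⇒<ᵇ≡true : ∀ {m k} → m < k → (m <ᵇ k) ≡ true
<⇒<ᵇ≡true {m} {k} lt with m <ᵇ k in eq
... | true = refl
... | false = ⊥-elim (<⇒≱ lt (<ᵇ≡false⇒≥ eq))

≥⇒<ᵇ≡false : ∀ {m k} → k ≤ m → (m <ᵇ k) ≡ false
≥⇒<ᵇ≡false {m} {k} le with m <ᵇ k in eq
... | true = ⊥-elim (<⇒≱ (<ᵇ≡true⇒< eq) le)
... | false = refl

module _ {A : Set} {R : A → A → Set} where

  linked-∷ʳ⁻ : ∀ xs {x} → Linked R (xs ∷ʳ x) → Linked R xs
  linked-∷ʳ⁻ [] _ = []
  linked-∷ʳ⁻ (a ∷ []) _ = [-]
  linked-∷ʳ⁻ (a ∷ b ∷ xs) (p ∷ l) = p ∷ linked-∷ʳ⁻ (b ∷ xs) l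

  linked-∷ʳ-last : ∀ xs {a b} → Linked R (xs ∷ʳ a ∷ʳ b) → R a b
  linked-∷ʳ-last [] (p ∷ _) = p
  linked-∷ʳ-last (x ∷ []) (_ ∷ l) = linked-∷ʳ-last [] l
  linked-∷ʳ-last (x ∷ y ∷ xs) (_ ∷ l) = linked-∷ʳ-last (y ∷ xs) l

  linked-∷ʳ⁺ : ∀ xs {a b} → Linked R (xs ∷ʳ a) → R a b → Linked R (xs ∷ʳ a ∷ʳ b)
  linked-∷ʳ⁺ [] _ p = p ∷ [-]
  linked-∷ʳ⁺ (x ∷ []) (q ∷ _) p = q ∷ p ∷ [-]
  linked-∷ʳ⁺ (x ∷ y ∷ xs) (q ∷ l) p = q ∷ linked-∷ʳ⁺ (y ∷ xs) l p

addCell : ℕ → List ℕ → List ℕ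
addCell _ [] = 1 ∷ []
addCell zero (l ∷ ls) = suc l ∷ ls
addCell (suc i) (l ∷ ls) = l ∷ addCell i ls

Decreasing : List ℕ → Set
Decreasing = Linked (λ a b → b ≤ a)

firstPart : List ℕ → ℕ
firstPart [] = 0
firstPart (l ∷ _) = l

AddableAt : ℕ → List ℕ → Set
AddableAt zero _ = ⊤
AddableAt (suc zero) (l ∷ ls) = firstPart ls < l
AddableAt (suc (suc r)) (l ∷ ls) = AddableAt (suc r) ls
AddableAt (suc _) [] = ⊤

addableAt-decreasing : ∀ r sh → Decreasing (addCell r sh) → r ≤ length sh → AddableAt r sh
addableAt-decreasing zero sh _ _ = tt
addableAt-decreasing (suc zero) (l ∷ []) (p ∷ _) _ = p
addableAt-decreasing (suc zero) (l ∷ m ∷ ms) (p ∷ _) _ = p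
addableAt-decreasing (suc (suc r)) (l ∷ ls) d (s≤s b) = addableAt-decreasing (suc r) ls (Linked.tail d) b

CornerAt : ℕ → List ℕ → Set
CornerAt _ [] = ⊥
CornerAt zero (l ∷ ls) = firstPart ls < l
CornerAt (suc i) (l ∷ ls) = CornerAt i ls

removeCellFromPart : ℕ → List ℕ → List ℕ
removeCellFromPart zero ls = 0 ∷ ls
removeCellFromPart (suc zero) ls = ls
removeCellFromPart (suc (suc k)) ls = suc k ∷ ls

removeCell : ℕ → List ℕ → List ℕ
removeCell _ [] = []
removeCell zero (l ∷ ls) = removeCellFromPart l ls
removeCell (suc i) (l ∷ ls) = l ∷ removeCell i ls

sum-addCell : ∀ r sh → sum (addCell r sh) ≡ suc (sum sh)
sum-addCell _ [] = refl
sum-addCell zero (l ∷ ls) = refl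
sum-addCell (suc r) (l ∷ ls) rewrite sum-addCell r ls = +-suc l (sum ls)

module _ {n : ℕ} where

  SortedRow : Row n → Set
  SortedRow = Linked _≼_

  bumpedRow : Bump n → Row n
  bumpedRow (appended r) = r
  bumpedRow (bumped r _) = r

  sorted-∷ : ∀ {a : Letter n} {xs} → All (a ≼_) xs → SortedRow xs → SortedRow (a ∷ xs)
  sorted-∷ [] _ = [-]
  sorted-∷ (p ∷ _) l = p ∷ l

  sorted-head≼ : ∀ {a : Letter n} {xs} → SortedRow (a ∷ xs) → All (a ≼_) xs
  sorted-head≼ [-] = []
  sorted-head≼ {a} (p ∷ l) = Linked⇒All (λ {i} {j} {k} → ≤-trans {int i} {int j} {int k}) {v = a} p l

  sorted-∷ʳ : ∀ {xs} {x : Letter n} → SortedRow xs → All (_≼ x) xs → SortedRow (xs ∷ʳ x)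
  sorted-∷ʳ [] [] = [-]
  sorted-∷ʳ [-] (p ∷ []) = p ∷ [-]
  sorted-∷ʳ (q ∷ l) (p ∷ ps) = q ∷ sorted-∷ʳ l ps

  rowInsert-appended : ∀ (x : Letter n) r {r'} → rowInsert x r ≡ appended r' → (r' ≡ r ∷ʳ x) × All (_≼ x) r
  rowInsert-appended x [] refl = refl , []
  rowInsert-appended x (y ∷ ys) eq with int x <ᵇ int y in e
  rowInsert-appended x (y ∷ ys) () | true
  ... | false with rowInsert x ys in e2
  rowInsert-appended x (y ∷ ys) refl | false | appended ys' with rowInsert-appended x ys e2
  ... | refl , al = refl , (<ᵇ≡false⇒≥ e ∷ al)

  rowInsert-bumped-≺ : ∀ (x : Letter n) r {r' z} → rowInsert x r ≡ bumped r' z → x ≺ z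
  rowInsert-bumped-≺ x [] ()
  rowInsert-bumped-≺ x (y ∷ ys) eq with int x <ᵇ int y in e
  rowInsert-bumped-≺ x (y ∷ ys) refl | true = <ᵇ≡true⇒< e
  ... | false with rowInsert x ys in e2
  rowInsert-bumped-≺ x (y ∷ ys) () | false | appended _
  rowInsert-bumped-≺ x (y ∷ ys) refl | false | bumped _ _ = rowInsert-bumped-≺ x ys e2

  rowInsert-bumped-head≼ : ∀ (x : Letter n) r {c cs z} → rowInsert x r ≡ bumped (c ∷ cs) z → c ≼ x
  rowInsert-bumped-head≼ x [] ()
  rowInsert-bumped-head≼ x (y ∷ ys) eq with int x <ᵇ int y in e
  rowInsert-bumped-head≼ x (y ∷ ys) refl | true = ≤-refl
  ... | false with rowInsert x ys in e2
  rowInsert-bumped-head≼ x (y ∷ ys) () | false | appended _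
  rowInsert-bumped-head≼ x (y ∷ ys) refl | false | bumped _ _ = <ᵇ≡false⇒≥ e

  rowInsert-bumped-head≺ : ∀ (x : Letter n) r {c cs z} → rowInsert x r ≡ bumped (c ∷ cs) z → c ≺ z
  rowInsert-bumped-head≺ x r eq = ≤-<-trans (rowInsert-bumped-head≼ x r eq) (rowInsert-bumped-≺ x r eq)

  rowInsert-bumped-pointwise : ∀ (x : Letter n) r {r' z} → rowInsert x r ≡ bumped r' z → Pointwise _≼_ r' r
  rowInsert-bumped-pointwise x [] ()
  rowInsert-bumped-pointwise x (y ∷ ys) eq with int x <ᵇ int y in e
  rowInsert-bumped-pointwise x (y ∷ ys) refl | true = <⇒≤ (<ᵇ≡true⇒< e) ∷ Pointwise.refl ≤-refl
  ... | false with rowInsert x ys in e2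
  rowInsert-bumped-pointwise x (y ∷ ys) () | false | appended _
  rowInsert-bumped-pointwise x (y ∷ ys) refl | false | bumped _ _ = ≤-refl ∷ rowInsert-bumped-pointwise x ys e2

  rowInsert-All : ∀ {P : Letter n → Set} x r → All P r → P x → All P (bumpedRow (rowInsert x r))
  rowInsert-All x [] [] p = p ∷ []
  rowInsert-All x (y ∷ ys) (q ∷ qs) p with int x <ᵇ int y
  ... | true = p ∷ qs
  ... | false with rowInsert x ys | rowInsert-All x ys qs p
  ... | appended _ | ih = q ∷ ih
  ... | bumped _ _ | ih = q ∷ ih

  rowInsert-All-bumped : ∀ {P : Letter n → Set} x r {r' z} → All P r → rowInsert x r ≡ bumped r' z → P z
  rowInsert-All-bumped x [] [] ()
  rowInsert-All-bumped x (y ∷ ys) (q ∷ qs) eq with int x <ᵇ int y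
  rowInsert-All-bumped x (y ∷ ys) (q ∷ qs) refl | true = q
  ... | false with rowInsert x ys in e2
  rowInsert-All-bumped x (y ∷ ys) (q ∷ qs) () | false | appended _
  rowInsert-All-bumped x (y ∷ ys) (q ∷ qs) refl | false | bumped _ _ = rowInsert-All-bumped x ys qs e2

  rowInsert-sorted : ∀ (x : Letter n) r → SortedRow r → SortedRow (bumpedRow (rowInsert x r))
  rowInsert-sorted x [] _ = [-]
  rowInsert-sorted x (y ∷ ys) l with int x <ᵇ int y in e
  ... | true = sorted-∷ (All.map (≤-trans (<⇒≤ (<ᵇ≡true⇒< e))) (sorted-head≼ l)) (Linked.tail l)
  ... | false with rowInsert x ys | rowInsert-All x ys (sorted-head≼ l) (<ᵇ≡false⇒≥ e) | rowInsert-sorted x ys (Linked.tail l)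
  ... | appended _ | al | ih = sorted-∷ al ih
  ... | bumped _ _ | al | ih = sorted-∷ al ih

  rowInsert-appended-length : ∀ (x : Letter n) r {r'} → rowInsert x r ≡ appended r' → length r' ≡ suc (length r)
  rowInsert-appended-length x r eq with rowInsert-appended x r eq
  ... | refl , _ = trans (length-++ r) (+-comm (length r) 1)

  rowInsert-bumped-length : ∀ (x : Letter n) r {r' z} → rowInsert x r ≡ bumped r' z → length r' ≡ length r
  rowInsert-bumped-length x r eq = Pointwise-length (rowInsert-bumped-pointwise x r eq)

  rowInsert-appends : ∀ (x : Letter n) r → All (_≼ x) r → rowInsert x r ≡ appended (r ∷ʳ x)
  rowInsert-appends x [] [] = refl
  rowInsert-appends x (y ∷ ys) (p ∷ ps) rewrite ≥⇒<ᵇ≡false {int x} {int y} p | rowInsert-appends x ys ps = refl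

  rowInsert-bumps-≼ : ∀ (x' x : Letter n) r → SortedRow r → Any (λ y → x' ≺ y × y ≼ x) r →
                      Σ (Row n) λ r' → Σ (Letter n) λ z → rowInsert x' r ≡ bumped r' z × z ≼ x
  rowInsert-bumps-≼ x' x (y ∷ ys) l a with int x' <ᵇ int y in e
  rowInsert-bumps-≼ x' x (y ∷ ys) l (here (_ , y≼x)) | true = _ , _ , refl , y≼x
  rowInsert-bumps-≼ x' x (y ∷ ys) l (there a) | true =
    let (y≼w , _ , w≼x) = lookupAny (sorted-head≼ l) a in _ , _ , refl , ≤-trans y≼w w≼x
  rowInsert-bumps-≼ x' x (y ∷ ys) l (here (x'≺y , _)) | false = ⊥-elim (<⇒≱ x'≺y (<ᵇ≡false⇒≥ e))
  rowInsert-bumps-≼ x' x (y ∷ ys) l (there a) | false with rowInsert x' ys | rowInsert-bumps-≼ x' x ys (Linked.tail l) a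
  ... | appended _ | _ , _ , () , _
  ... | bumped _ _ | _ , _ , refl , z≼x = _ , _ , refl , z≼x

  ColBelowHead : Row n → Tableau n → Set
  ColBelowHead r [] = ⊤
  ColBelowHead r (s ∷ _) = ColBelow r s

  columns-∷ : ∀ {r : Row n} {T} → ColBelowHead r T → Linked ColBelow T → Linked ColBelow (r ∷ T)
  columns-∷ {T = []} _ _ = [-]
  columns-∷ {T = s ∷ T} h l = h ∷ l

  columns-head : ∀ {r : Row n} {T} → Linked ColBelow (r ∷ T) → ColBelowHead r T
  columns-head [-] = tt
  columns-head (h ∷ _) = h

  colBelow-pointwise : ∀ {as' as bs : Row n} → ColBelow as bs → Pointwise _≼_ as' as → ColBelow as' bs
  colBelow-pointwise {bs = []} _ _ = tt
  colBelow-pointwise {bs = b ∷ bs} (p , c) (q ∷ pw) = ≤-<-trans q p , colBelow-pointwise c pw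

  colBelow-∷ʳ-upper : ∀ {r s : Row n} {x} → ColBelow r s → ColBelow (r ∷ʳ x) s
  colBelow-∷ʳ-upper {s = []} _ = tt
  colBelow-∷ʳ-upper {r = a ∷ r} {s = b ∷ s} (p , c) = p , colBelow-∷ʳ-upper c

  colBelow-length : ∀ {r s : Row n} → ColBelow r s → length s ≤ length r
  colBelow-length {s = []} _ = z≤n
  colBelow-length {r = a ∷ r} {s = b ∷ s} (_ , c) = s≤s (colBelow-length c)

  rowInsert-colBelow : ∀ (x : Letter n) r s {r' z} → ColBelow r s → rowInsert x r ≡ bumped r' z →
         ColBelow r' (bumpedRow (rowInsert z s))
  rowInsert-colBelow x [] s _ ()
  rowInsert-colBelow x (a ∷ as) [] c eq with int x <ᵇ int a in e
  rowInsert-colBelow x (a ∷ as) [] c refl | true = <ᵇ≡true⇒< e , tt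
  ... | false with rowInsert x as in e2
  rowInsert-colBelow x (a ∷ as) [] c () | false | appended _
  rowInsert-colBelow x (a ∷ as) [] c refl | false | bumped _ _ = ≤-<-trans (<ᵇ≡false⇒≥ e) (rowInsert-bumped-≺ x as e2) , tt
  rowInsert-colBelow x (a ∷ as) (b ∷ bs) (ab , c) eq with int x <ᵇ int a in e
  rowInsert-colBelow x (a ∷ as) (b ∷ bs) (ab , c) refl | true rewrite <⇒<ᵇ≡true {int a} {int b} ab = <ᵇ≡true⇒< e , c
  ... | false with rowInsert x as in e2
  rowInsert-colBelow x (a ∷ as) (b ∷ bs) (ab , c) () | false | appended _
  rowInsert-colBelow x (a ∷ as) (b ∷ bs) (ab , c) refl | false | bumped as' z with int z <ᵇ int b in e3
  ... | true = ≤-<-trans (<ᵇ≡false⇒≥ e) (rowInsert-bumped-≺ x as e2) , colBelow-pointwise c (rowInsert-bumped-pointwise x as e2)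
  ... | false with rowInsert z bs | rowInsert-colBelow x as bs c e2
  ... | appended _ | ih = ab , ih
  ... | bumped _ _ | ih = ab , ih

  rowInsert-colBelow-bumped : ∀ (x : Letter n) r {r' z} → rowInsert x r ≡ bumped r' z → ColBelow r' (z ∷ [])
  rowInsert-colBelow-bumped x r {c ∷ cs} eq = rowInsert-bumped-head≺ x r eq , tt
  rowInsert-colBelow-bumped x [] {[]} ()
  rowInsert-colBelow-bumped x (a ∷ as) {[]} eq with rowInsert-bumped-pointwise x (a ∷ as) eq
  ... | ()

  insert-shape : ∀ (x : Letter n) T {T' i} → insert x T ≡ (T' , i) → (shape T' ≡ addCell i (shape T)) × (i ≤ length T)
  insert-shape x [] refl = refl , z≤n
  insert-shape x (r ∷ rs) eq with rowInsert x r in e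
  insert-shape x (r ∷ rs) refl | appended r' = cong (_∷ shape rs) (rowInsert-appended-length x r e) , z≤n
  ... | bumped r' z with insert z rs in e2
  insert-shape x (r ∷ rs) refl | bumped r' z | rs' , i with insert-shape z rs e2
  ... | sh , b = cong₂ _∷_ (rowInsert-bumped-length x r e) sh , s≤s b

  RowsSorted : Tableau n → Set
  RowsSorted T = All (SortedRow) T

  insert-nonEmpty : ∀ (x : Letter n) T {T' i} → All NonEmpty T → insert x T ≡ (T' , i) → All NonEmpty T'
  insert-nonEmpty x [] _ refl = tt ∷ []
  insert-nonEmpty x (r ∷ rs) (p ∷ ps) eq with rowInsert x r in e
  insert-nonEmpty x (r ∷ rs) (p ∷ ps) refl | appended r' with rowInsert-appended x r e
  ... | refl , _ = ne++ r p ∷ ps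
    where
    ne++ : ∀ (r : Row n) → NonEmpty r → NonEmpty (r ∷ʳ x)
    ne++ (_ ∷ _) _ = tt
  insert-nonEmpty x (r ∷ rs) (p ∷ ps) eq | bumped r' z with insert z rs in e2
  insert-nonEmpty x (r ∷ rs) (p ∷ ps) refl | bumped r' z | rs' , i = ne r' (rowInsert-bumped-pointwise x r e) p ∷ insert-nonEmpty z rs ps e2
    where
    ne : ∀ (r' : Row n) {r} → Pointwise _≼_ r' r → NonEmpty r → NonEmpty r'
    ne (_ ∷ _) _ _ = tt
    ne [] [] ()

  insert-rowsSorted : ∀ (x : Letter n) T {T' i} → RowsSorted T → insert x T ≡ (T' , i) → RowsSorted T'
  insert-rowsSorted x [] _ refl = [-] ∷ []
  insert-rowsSorted x (r ∷ rs) (p ∷ ps) eq with rowInsert x r in e | rowInsert-sorted x r p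
  insert-rowsSorted x (r ∷ rs) (p ∷ ps) refl | appended r' | q = q ∷ ps
  ... | bumped r' z | q with insert z rs in e2
  insert-rowsSorted x (r ∷ rs) (p ∷ ps) refl | bumped r' z | q | rs' , i = q ∷ insert-rowsSorted z rs ps e2

  insert-columns : ∀ (x : Letter n) T {T' i} → Linked ColBelow T → insert x T ≡ (T' , i) → Linked ColBelow T'
  insert-columns x [] _ refl = [-]
  insert-columns x (r ∷ rs) l eq with rowInsert x r in e
  insert-columns x (r ∷ rs) l refl | appended r' with rowInsert-appended x r e
  ... | refl , _ = columns-∷ (hc rs (columns-head l)) (Linked.tail l)
    where
    hc : ∀ rs → ColBelowHead r rs → ColBelowHead (r ∷ʳ x) rs
    hc [] _ = tt
    hc (s ∷ _) c = colBelow-∷ʳ-upper c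
  insert-columns x (r ∷ rs) l eq | bumped r' z with insert z rs in e2
  insert-columns x (r ∷ rs) l refl | bumped r' z | rs' , i = columns-∷ (hc rs (columns-head l) e2) (insert-columns z rs (Linked.tail l) e2)
    where
    hc : ∀ rs {rs' i} → ColBelowHead r rs → insert z rs ≡ (rs' , i) → ColBelowHead r' rs'
    hc [] _ refl = rowInsert-colBelow-bumped x r e
    hc (s ∷ ss) h eq2 with rowInsert z s in e3 | rowInsert-colBelow x r s h e
    hc (s ∷ ss) h refl | appended _ | cl = cl
    ... | bumped _ z' | cl with insert z' ss
    hc (s ∷ ss) h refl | bumped _ z' | cl | _ = cl

  -- The row bumping lemma

  insert-appended : ∀ (x : Letter n) r rs {r'} → rowInsert x r ≡ appended r' → insert x (r ∷ rs) ≡ (r' ∷ rs , 0)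
  insert-appended x r rs e with rowInsert x r
  insert-appended x r rs refl | appended _ = refl

  rowInsert-twice-≼ : ∀ (x x' : Letter n) r {r1 z r2 z'} → SortedRow r → x ≼ x' →
          rowInsert x r ≡ bumped r1 z → rowInsert x' r1 ≡ bumped r2 z' → z ≼ z'
  rowInsert-twice-≼ x x' [] l le () e'
  rowInsert-twice-≼ x x' (a ∷ as) l le e e' with int x <ᵇ int a in ea
  rowInsert-twice-≼ x x' (a ∷ as) l le refl e' | true with int x' <ᵇ int x in eb
  ... | true = ⊥-elim (<⇒≱ (<ᵇ≡true⇒< eb) le)
  ... | false with rowInsert x' as in ec
  rowInsert-twice-≼ x x' (a ∷ as) l le refl () | true | false | appended _
  rowInsert-twice-≼ x x' (a ∷ as) l le refl refl | true | false | bumped _ _ = rowInsert-All-bumped x' as (sorted-head≼ l) ec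
  rowInsert-twice-≼ x x' (a ∷ as) l le e e' | false with rowInsert x as in ec
  rowInsert-twice-≼ x x' (a ∷ as) l le () e' | false | appended _
  rowInsert-twice-≼ x x' (a ∷ as) l le refl e' | false | bumped as1 z with int x' <ᵇ int a in eb
  ... | true = ⊥-elim (<⇒≱ (<ᵇ≡true⇒< eb) (≤-trans (<ᵇ≡false⇒≥ {int x} {int a} ea) le))
  ... | false with rowInsert x' as1 in ed
  rowInsert-twice-≼ x x' (a ∷ as) l le refl () | false | bumped as1 z | false | appended _
  rowInsert-twice-≼ x x' (a ∷ as) l le refl refl | false | bumped as1 z | false | bumped _ _ = rowInsert-twice-≼ x x' as (Linked.tail l) le ec ed

  insert-twice-weaklyAbove : ∀ (x x' : Letter n) T {T1 i T2 i'} → RowsSorted T → x ≼ x' →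
           insert x T ≡ (T1 , i) → insert x' T1 ≡ (T2 , i') → i' ≤ i
  insert-twice-weaklyAbove x x' [] s le refl e' with int x' <ᵇ int x in eb
  ... | true = ⊥-elim (<⇒≱ (<ᵇ≡true⇒< eb) le)
  insert-twice-weaklyAbove x x' [] s le refl refl | false = z≤n
  insert-twice-weaklyAbove x x' (r ∷ rs) (sr ∷ ss) le e e' with rowInsert x r in ea
  insert-twice-weaklyAbove x x' (r ∷ rs) (sr ∷ ss) le refl e' | appended r1 with rowInsert-appended x r ea
  ... | refl , al
    with trans (sym (insert-appended x' (r ∷ʳ x) rs (rowInsert-appends x' (r ∷ʳ x) (∷ʳ⁺ (All.map (λ p → ≤-trans p le) al) le)))) e'
  ... | refl = z≤n
  insert-twice-weaklyAbove x x' (r ∷ rs) (sr ∷ ss) le e e' | bumped r1 z with insert z rs in eb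
  insert-twice-weaklyAbove x x' (r ∷ rs) (sr ∷ ss) le refl e' | bumped r1 z | rs1 , j with rowInsert x' r1 in ec
  insert-twice-weaklyAbove x x' (r ∷ rs) (sr ∷ ss) le refl refl | bumped r1 z | rs1 , j | appended _ = z≤n
  ... | bumped r2 z' with insert z' rs1 in ed
  insert-twice-weaklyAbove x x' (r ∷ rs) (sr ∷ ss) le refl refl | bumped r1 z | rs1 , j | bumped r2 z' | rs2 , j' =
    s≤s (insert-twice-weaklyAbove z z' rs ss (rowInsert-twice-≼ x x' r sr le ea ec) eb ed)

  rowInsert-bumped-Any : ∀ {P : Letter n → Set} (x : Letter n) r {r1 z} → P x → rowInsert x r ≡ bumped r1 z → Any P r1
  rowInsert-bumped-Any x [] p ()
  rowInsert-bumped-Any x (a ∷ as) p e with int x <ᵇ int a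
  rowInsert-bumped-Any x (a ∷ as) p refl | true = here p
  ... | false with rowInsert x as in ec
  rowInsert-bumped-Any x (a ∷ as) p () | false | appended _
  rowInsert-bumped-Any x (a ∷ as) p refl | false | bumped _ _ = there (rowInsert-bumped-Any x as p ec)

  insert-twice-strictlyBelow : ∀ (x x' : Letter n) T {T1 i T2 i'} → RowsSorted T → x' ≺ x →
           insert x T ≡ (T1 , i) → insert x' T1 ≡ (T2 , i') → i < i'
  insert-twice-strictlyBelow x x' [] s lt refl e' rewrite <⇒<ᵇ≡true {int x'} {int x} lt with e'
  ... | refl = s≤s z≤n
  insert-twice-strictlyBelow x x' (r ∷ rs) (sr ∷ ss) lt e e' with rowInsert x r in ea
  insert-twice-strictlyBelow x x' (r ∷ rs) (sr ∷ ss) lt refl e' | appended r1 with rowInsert-appended x r ea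
  ... | refl , al with rowInsert-bumps-≼ x' x (r ∷ʳ x) (sorted-∷ʳ sr al) (++⁺ʳ r (here (lt , ≤-refl)))
  ... | r2 , z' , ec , _ with rowInsert x' (r ∷ʳ x)
  insert-twice-strictlyBelow x x' (r ∷ rs) (sr ∷ ss) lt refl e' | appended r1 | refl , al | r2 , z' , refl , _ | bumped _ _ with insert z' rs
  insert-twice-strictlyBelow x x' (r ∷ rs) (sr ∷ ss) lt refl refl | appended r1 | refl , al | r2 , z' , refl , _ | bumped _ _ | _ = s≤s z≤n
  insert-twice-strictlyBelow x x' (r ∷ rs) (sr ∷ ss) lt e e' | bumped r1 z with insert z rs in eb
  insert-twice-strictlyBelow x x' (r ∷ rs) (sr ∷ ss) lt refl e' | bumped r1 z | rs1 , j
    with rowInsert-bumps-≼ x' x r1 (subst (λ b → SortedRow (bumpedRow b)) ea (rowInsert-sorted x r sr))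
                                   (rowInsert-bumped-Any x r (lt , ≤-refl) ea)
  ... | r2 , z' , ec , z'x with rowInsert x' r1
  insert-twice-strictlyBelow x x' (r ∷ rs) (sr ∷ ss) lt refl e' | bumped r1 z | rs1 , j | r2 , z' , refl , z'x | bumped _ _ with insert z' rs1 in ed
  insert-twice-strictlyBelow x x' (r ∷ rs) (sr ∷ ss) lt refl refl | bumped r1 z | rs1 , j | r2 , z' , refl , z'x | bumped _ _ | rs2 , j' =
    s≤s (insert-twice-strictlyBelow z z' rs ss (≤-<-trans z'x (rowInsert-bumped-≺ x r ea)) eb ed)

  Bounded : ℕ → Tableau n → Set
  Bounded m U = All (All (λ a → int a ≤ m)) U

  BoundedAbove : ℕ → ℕ → Tableau n → Set
  BoundedAbove m zero U = ⊤
  BoundedAbove m (suc r) [] = ⊤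
  BoundedAbove m (suc r) (R ∷ Us) = All (λ a → int a < m) R × BoundedAbove m r Us

  shape-decreasing : ∀ (U : Tableau n) → Linked ColBelow U → Decreasing (shape U)
  shape-decreasing [] _ = []
  shape-decreasing (R ∷ []) _ = [-]
  shape-decreasing (R ∷ S ∷ Ss) (c ∷ l) = colBelow-length c ∷ shape-decreasing (S ∷ Ss) l

  placeAt-shape : ∀ i (t : Letter n) U → shape (placeAt i t U) ≡ addCell i (shape U)
  placeAt-shape _ t [] = refl
  placeAt-shape zero t (R ∷ Us) = cong (_∷ shape Us) (trans (length-++ R) (+-comm (length R) 1))
  placeAt-shape (suc i) t (R ∷ Us) = cong (length R ∷_) (placeAt-shape i t Us)

  placeAt-bounded : ∀ {m} i (t : Letter n) U → Bounded m U → int t ≤ m → Bounded m (placeAt i t U)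
  placeAt-bounded _ t [] _ p = (p ∷ []) ∷ []
  placeAt-bounded zero t (R ∷ Us) (a ∷ as) p = ∷ʳ⁺ a p ∷ as
  placeAt-bounded (suc i) t (R ∷ Us) (a ∷ as) p = a ∷ placeAt-bounded i t Us as p

  placeAt-bounded⁻ : ∀ {m} i (t : Letter n) U → Bounded m (placeAt i t U) → int t ≤ m × Bounded m U
  placeAt-bounded⁻ _ t [] ((p ∷ []) ∷ []) = p , []
  placeAt-bounded⁻ zero t (R ∷ Us) (a ∷ as) = proj₂ (∷ʳ⁻ a) , (proj₁ (∷ʳ⁻ a) ∷ as)
  placeAt-bounded⁻ (suc i) t (R ∷ Us) (a ∷ as) = proj₁ (placeAt-bounded⁻ i t Us as) , (a ∷ proj₂ (placeAt-bounded⁻ i t Us as))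

  placeAt-boundedAbove : ∀ {m} r j (t : Letter n) U → r ≤ j → j ≤ length U → BoundedAbove m r U → BoundedAbove m r (placeAt j t U)
  placeAt-boundedAbove zero j t U _ _ _ = tt
  placeAt-boundedAbove (suc r) (suc j) t [] _ () _
  placeAt-boundedAbove (suc r) (suc j) t (R ∷ Us) (s≤s b) (s≤s b2) (a , p) = a , placeAt-boundedAbove r j t Us b b2 p

  placeAt-boundedAbove⁻ : ∀ {m} r j (t : Letter n) U → r ≤ j → BoundedAbove m r (placeAt j t U) → BoundedAbove m r U
  placeAt-boundedAbove⁻ zero j t U _ _ = tt
  placeAt-boundedAbove⁻ (suc r) j t [] _ _ = tt
  placeAt-boundedAbove⁻ (suc r) (suc j) t (R ∷ Us) (s≤s b) (a , p) = a , placeAt-boundedAbove⁻ r j t Us b p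

  placeAt-boundedAbove-placed : ∀ {m} r j (t : Letter n) U → j < r → j ≤ length U → BoundedAbove m r (placeAt j t U) → int t < m
  placeAt-boundedAbove-placed (suc r) j t [] _ _ ((p ∷ []) , _) = p
  placeAt-boundedAbove-placed (suc r) zero t (R ∷ Us) _ _ (a , _) = proj₂ (∷ʳ⁻ a)
  placeAt-boundedAbove-placed (suc r) (suc j) t (R ∷ Us) (s≤s lt) (s≤s b) (_ , p) = placeAt-boundedAbove-placed r j t Us lt b p

  boundedAbove-mono : ∀ {m} r j (U : Tableau n) → j ≤ r → BoundedAbove m r U → BoundedAbove m j U
  boundedAbove-mono r zero U _ _ = tt
  boundedAbove-mono (suc r) (suc j) [] _ _ = tt
  boundedAbove-mono (suc r) (suc j) (R ∷ Us) (s≤s b) (a , p) = a , boundedAbove-mono r j Us b p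

  bounded⇒boundedAbove : ∀ {k m} r (U : Tableau n) → Bounded k U → k < m → BoundedAbove m r U
  bounded⇒boundedAbove zero U _ _ = tt
  bounded⇒boundedAbove (suc r) [] _ _ = tt
  bounded⇒boundedAbove (suc r) (R ∷ Us) (a ∷ as) lt = All.map (λ p → ≤-<-trans p lt) a , bounded⇒boundedAbove r Us as lt

  placeAt-nonEmpty : ∀ i (t : Letter n) U → All NonEmpty U → All NonEmpty (placeAt i t U)
  placeAt-nonEmpty _ t [] _ = tt ∷ []
  placeAt-nonEmpty zero t ((_ ∷ _) ∷ Us) (p ∷ ps) = tt ∷ ps
  placeAt-nonEmpty (suc i) t (R ∷ Us) (p ∷ ps) = p ∷ placeAt-nonEmpty i t Us ps

  placeAt-rowsSorted : ∀ i (t : Letter n) U → RowsSorted U → Bounded (int t) U → RowsSorted (placeAt i t U)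
  placeAt-rowsSorted _ t [] _ _ = [-] ∷ []
  placeAt-rowsSorted zero t (R ∷ Us) (s ∷ ss) (a ∷ _) = sorted-∷ʳ s a ∷ ss
  placeAt-rowsSorted (suc i) t (R ∷ Us) (s ∷ ss) (_ ∷ as) = s ∷ placeAt-rowsSorted i t Us ss as

  colBelow-∷ʳ-lower : ∀ (R S : Row n) {t} → ColBelow R S → length S < length R → All (λ a → int a < int t) R → ColBelow R (S ∷ʳ t)
  colBelow-∷ʳ-lower (a ∷ as) [] _ _ (p ∷ _) = p , tt
  colBelow-∷ʳ-lower (a ∷ as) (b ∷ bs) (ab , c) (s≤s lt) (p ∷ ps) = ab , colBelow-∷ʳ-lower as bs c lt ps

  placeAt-columns : ∀ i (t : Letter n) U → All NonEmpty U → Linked ColBelow U → BoundedAbove (int t) i U →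
            AddableAt i (shape U) → i ≤ length U → Linked ColBelow (placeAt i t U)
  placeAt-columns _ t [] _ _ _ _ _ = [-]
  placeAt-columns zero t (R ∷ Us) _ l _ _ _ = columns-∷ (hc Us (columns-head l)) (Linked.tail l)
    where
    hc : ∀ Us → ColBelowHead R Us → ColBelowHead (R ∷ʳ t) Us
    hc [] _ = tt
    hc (S ∷ _) c = colBelow-∷ʳ-upper c
  placeAt-columns (suc zero) t ((a ∷ as) ∷ []) _ l ((p ∷ _) , _) ok _ = (p , tt) ∷ [-]
  placeAt-columns (suc zero) t (R ∷ S ∷ Ss) (_ ∷ ne) l (al , _) ok _ =
    columns-∷ (colBelow-∷ʳ-lower R S (columns-head l) ok al) (placeAt-columns zero t (S ∷ Ss) ne (Linked.tail l) tt tt z≤n)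
  placeAt-columns (suc (suc i)) t (R ∷ S ∷ Ss) (_ ∷ ne) l (_ , tp) ok (s≤s b) =
    columns-∷ (columns-head l) (placeAt-columns (suc i) t (S ∷ Ss) ne (Linked.tail l) tp ok b)

  -- Reverse bumping

  splitLast : Letter n → Row n → Row n × Letter n
  splitLast a [] = ([] , a)
  splitLast a (b ∷ bs) = (a ∷ proj₁ (splitLast b bs) , proj₂ (splitLast b bs))

  -- The letter d is a junk value, returned only when there is no cell to remove.
  dropLastCell : Letter n → Row n → Tableau n → Tableau n × Letter n
  dropLastCell d [] Rs = ([] ∷ Rs , d)
  dropLastCell d (a ∷ []) Rs = (Rs , a)
  dropLastCell d (a ∷ b ∷ bs) Rs = (proj₁ (splitLast a (b ∷ bs)) ∷ Rs , proj₂ (splitLast a (b ∷ bs)))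

  -- y replaces the rightmost entry smaller than y, and that entry is returned.
  unbumpRow∷ : Letter n → Letter n → Row n → Row n × Letter n
  unbumpRow∷ y a [] = (y ∷ [] , a)
  unbumpRow∷ y a (b ∷ bs) with int b <ᵇ int y
  ... | true = (a ∷ proj₁ (unbumpRow∷ y b bs) , proj₂ (unbumpRow∷ y b bs))
  ... | false = (y ∷ b ∷ bs , a)

  unbumpRow : Letter n → Row n → Row n × Letter n
  unbumpRow y [] = ([] , y)
  unbumpRow y (a ∷ as) = unbumpRow∷ y a as

  unbump : Letter n → ℕ → Tableau n → Tableau n × Letter n
  unbump d _ [] = ([] , d)
  unbump d zero (R ∷ Rs) = dropLastCell d R Rs
  unbump d (suc i) (R ∷ Rs) =
    (proj₁ (unbumpRow (proj₂ (unbump d i Rs)) R) ∷ proj₁ (unbump d i Rs) , proj₂ (unbumpRow (proj₂ (unbump d i Rs)) R))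

  removeCorner : Letter n → ℕ → Tableau n → Tableau n × Letter n
  removeCorner d _ [] = ([] , d)
  removeCorner d zero (R ∷ Rs) = dropLastCell d R Rs
  removeCorner d (suc i) (R ∷ Rs) = (R ∷ proj₁ (removeCorner d i Rs) , proj₂ (removeCorner d i Rs))

  splitLast-∷ʳ : ∀ (a : Letter n) as x → splitLast a (as ∷ʳ x) ≡ (a ∷ as , x)
  splitLast-∷ʳ a [] x = refl
  splitLast-∷ʳ a (b ∷ bs) x rewrite splitLast-∷ʳ b bs x = refl

  splitLast-rejoin : ∀ (a : Letter n) as → proj₁ (splitLast a as) ++ proj₂ (splitLast a as) ∷ [] ≡ a ∷ as
  splitLast-rejoin a [] = refl
  splitLast-rejoin a (b ∷ bs) = cong (a ∷_) (splitLast-rejoin b bs)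

  splitLast-length : ∀ (a : Letter n) as → length (proj₁ (splitLast a as)) ≡ length as
  splitLast-length a [] = refl
  splitLast-length a (b ∷ bs) = cong suc (splitLast-length b bs)

  head≼splitLast : ∀ (a : Letter n) as → SortedRow (a ∷ as) → a ≼ proj₂ (splitLast a as)
  head≼splitLast a [] _ = ≤-refl
  head≼splitLast a (b ∷ bs) (p ∷ l) = ≤-trans p (head≼splitLast b bs l)

  splitLast-sorted : ∀ (a : Letter n) as → SortedRow (a ∷ as) → SortedRow (proj₁ (splitLast a as))
  splitLast-sorted a [] _ = []
  splitLast-sorted a (b ∷ []) _ = [-]
  splitLast-sorted a (b ∷ c ∷ cs) (p ∷ l) = p ∷ splitLast-sorted b (c ∷ cs) l

  splitLast-≼last : ∀ (a : Letter n) as → SortedRow (a ∷ as) → All (_≼ proj₂ (splitLast a as)) (proj₁ (splitLast a as))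
  splitLast-≼last a [] _ = []
  splitLast-≼last a (b ∷ bs) (p ∷ l) = ≤-trans p (head≼splitLast b bs l) ∷ splitLast-≼last b bs l

  colBelow-init-upper : ∀ (b : Letter n) bs Y → ColBelow (b ∷ bs) Y → length Y ≤ length bs → ColBelow (proj₁ (splitLast b bs)) Y
  colBelow-init-upper b bs [] _ _ = tt
  colBelow-init-upper b (b2 ∷ bs) (c ∷ cs) (p , q) (s≤s l) = p , colBelow-init-upper b2 bs cs q l

  colBelowHead-init-upper : ∀ (a b : Letter n) bs Ss → ColBelowHead (a ∷ b ∷ bs) Ss →
                            firstPart (shape Ss) < suc (suc (length bs)) → ColBelowHead (proj₁ (splitLast a (b ∷ bs))) Ss
  colBelowHead-init-upper a b bs [] _ _ = tt
  colBelowHead-init-upper a b bs (S ∷ _) cb (s≤s lt) = colBelow-init-upper a (b ∷ bs) S cb lt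

  unbumpRow-length : ∀ (y : Letter n) R → length (proj₁ (unbumpRow y R)) ≡ length R
  unbumpRow-length y [] = refl
  unbumpRow-length y (a ∷ as) = go a as
    where
    go : ∀ a as → length (proj₁ (unbumpRow∷ y a as)) ≡ suc (length as)
    go a [] = refl
    go a (b ∷ bs) with int b <ᵇ int y
    ... | true = cong suc (go b bs)
    ... | false = refl

  unbumpRow-head≼ : ∀ (y a : Letter n) as → SortedRow (a ∷ as) → a ≼ proj₂ (unbumpRow y (a ∷ as))
  unbumpRow-head≼ y a [] _ = ≤-refl
  unbumpRow-head≼ y a (b ∷ bs) (p ∷ l) with int b <ᵇ int y
  ... | true = ≤-trans p (unbumpRow-head≼ y b bs l)
  ... | false = ≤-refl

  unbumpRow-≺ : ∀ (y a : Letter n) as → a ≺ y → proj₂ (unbumpRow y (a ∷ as)) ≺ y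
  unbumpRow-≺ y a [] p = p
  unbumpRow-≺ y a (b ∷ bs) p with int b <ᵇ int y in e
  ... | true = unbumpRow-≺ y b bs (<ᵇ≡true⇒< e)
  ... | false = p

  HeadSatisfies : (Letter n → Set) → Row n → Set
  HeadSatisfies P [] = ⊤
  HeadSatisfies P (c ∷ _) = P c

  unbumpRow-head : ∀ (P : Letter n → Set) (v a : Letter n) as → P a → P v → HeadSatisfies P (proj₁ (unbumpRow v (a ∷ as)))
  unbumpRow-head P v a [] p q = q
  unbumpRow-head P v a (b ∷ bs) p q with int b <ᵇ int v
  ... | true = p
  ... | false = q

  unbumpRow-nonEmpty : ∀ (y a : Letter n) as → NonEmpty (proj₁ (unbumpRow y (a ∷ as)))
  unbumpRow-nonEmpty y a [] = tt
  unbumpRow-nonEmpty y a (b ∷ bs) with int b <ᵇ int y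
  ... | true = tt
  ... | false = tt

  colBelow-singleton : ∀ (X : Row n) w → NonEmpty X → HeadSatisfies (_≺ w) X → ColBelow X (w ∷ [])
  colBelow-singleton (c ∷ cs) w _ p = p , tt

  sorted-∷′ : ∀ {a : Letter n} {xs} → HeadSatisfies (a ≼_) xs → SortedRow xs → SortedRow (a ∷ xs)
  sorted-∷′ {xs = []} _ _ = [-]
  sorted-∷′ {xs = _ ∷ _} p l = p ∷ l

  unbumpRow-sorted : ∀ (y a : Letter n) as → SortedRow (a ∷ as) → a ≺ y → SortedRow (proj₁ (unbumpRow y (a ∷ as)))
  unbumpRow-sorted y a [] _ _ = [-]
  unbumpRow-sorted y a (b ∷ bs) (p ∷ l) ay with int b <ᵇ int y in e
  ... | true = sorted-∷′ (unbumpRow-head (a ≼_) y b bs p (<⇒≤ ay)) (unbumpRow-sorted y b bs l (<ᵇ≡true⇒< e))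
  ... | false = <ᵇ≡false⇒≥ e ∷ l

  unbumpRow-rowInsert : ∀ (x : Letter n) r {r' z} → SortedRow r → rowInsert x r ≡ bumped r' z → unbumpRow z r' ≡ (r , x)
  unbumpRow-rowInsert x [] _ ()
  unbumpRow-rowInsert x (a ∷ as) l e with int x <ᵇ int a in ea
  unbumpRow-rowInsert x (a ∷ []) l refl | true = refl
  unbumpRow-rowInsert x (a ∷ b ∷ bs) (p ∷ l) refl | true rewrite ≥⇒<ᵇ≡false {int b} {int a} p = refl
  ... | false with rowInsert x as in e2
  unbumpRow-rowInsert x (a ∷ as) l () | false | appended _
  unbumpRow-rowInsert x (a ∷ as) l refl | false | bumped [] z = ⊥-elim (noEmpty x as e2)
    where
    noEmpty : ∀ x as {z} → rowInsert x as ≡ bumped [] z → ⊥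
    noEmpty x [] ()
    noEmpty x (c ∷ cs) e with rowInsert-bumped-pointwise x (c ∷ cs) e
    ... | ()
  unbumpRow-rowInsert x (a ∷ as) l refl | false | bumped (b' ∷ bs') z
    rewrite <⇒<ᵇ≡true {int b'} {int z} (rowInsert-bumped-head≺ x as e2) | unbumpRow-rowInsert x as (Linked.tail l) e2 = refl

  rowInsert-unbumpRow : ∀ (y a : Letter n) as → SortedRow (a ∷ as) → a ≺ y →
            rowInsert (proj₂ (unbumpRow∷ y a as)) (proj₁ (unbumpRow∷ y a as)) ≡ bumped (a ∷ as) y
  rowInsert-unbumpRow y a [] _ ay rewrite <⇒<ᵇ≡true {int a} {int y} ay = refl
  rowInsert-unbumpRow y a (b ∷ bs) (p ∷ l) ay with int b <ᵇ int y in e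
  ... | true rewrite ≥⇒<ᵇ≡false {int (proj₂ (unbumpRow∷ y b bs))} {int a} (≤-trans p (unbumpRow-head≼ y b bs l))
                   | rowInsert-unbumpRow y b bs l (<ᵇ≡true⇒< e) = refl
  ... | false rewrite <⇒<ᵇ≡true {int a} {int y} ay = refl

  insert-bumped : ∀ (x : Letter n) r rs {r' z rs' j} → rowInsert x r ≡ bumped r' z → insert z rs ≡ (rs' , j) →
                 insert x (r ∷ rs) ≡ (r' ∷ rs' , suc j)
  insert-bumped x r rs e e2 with rowInsert x r
  insert-bumped x r rs refl e2 | bumped _ z with insert z rs
  insert-bumped x r rs refl refl | bumped _ z | _ = refl

  dropLastCell-∷ʳ : ∀ d (a : Letter n) as x rs → dropLastCell d (a ∷ as ∷ʳ x) rs ≡ ((a ∷ as) ∷ rs , x)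
  dropLastCell-∷ʳ d a [] x rs = refl
  dropLastCell-∷ʳ d a (b ∷ bs) x rs rewrite splitLast-∷ʳ b bs x = refl

  unbump-insert : ∀ d (x : Letter n) T {T' i} → RowsSorted T → All NonEmpty T → insert x T ≡ (T' , i) → unbump d i T' ≡ (T , x)
  unbump-insert d x [] _ _ refl = refl
  unbump-insert d x (r ∷ rs) (sr ∷ ss) (nr ∷ ns) e with rowInsert x r in ea
  unbump-insert d x (r ∷ rs) (sr ∷ ss) (nr ∷ ns) refl | appended r' with rowInsert-appended x r ea
  unbump-insert d x ((a ∷ as) ∷ rs) (sr ∷ ss) (nr ∷ ns) refl | appended r' | refl , _ = dropLastCell-∷ʳ d a as x rs
  unbump-insert d x (r ∷ rs) (sr ∷ ss) (nr ∷ ns) e | bumped r' z with insert z rs in eb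
  unbump-insert d x (r ∷ rs) (sr ∷ ss) (nr ∷ ns) refl | bumped r' z | rs' , j
    rewrite unbump-insert d z rs ss ns eb | unbumpRow-rowInsert x r sr ea = refl

  removeCorner-placeAt : ∀ d i (t : Letter n) U → All NonEmpty U → i ≤ length U → removeCorner d i (placeAt i t U) ≡ (U , t)
  removeCorner-placeAt d zero t [] _ _ = refl
  removeCorner-placeAt d zero t ((a ∷ as) ∷ Us) _ _ = dropLastCell-∷ʳ d a as t Us
  removeCorner-placeAt d zero t ([] ∷ Us) (() ∷ _) _
  removeCorner-placeAt d (suc i) t (R ∷ Us) (_ ∷ ns) (s≤s b) rewrite removeCorner-placeAt d i t Us ns b = refl

  shorter-than-one : ∀ (Ss : Tableau n) → All NonEmpty Ss → firstPart (shape Ss) < 1 → Ss ≡ []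
  shorter-than-one [] _ _ = refl
  shorter-than-one ((_ ∷ _) ∷ _) _ (s≤s ())
  shorter-than-one ([] ∷ _) (() ∷ _) _

  placeAt-removeCorner : ∀ d i (U : Tableau n) → All NonEmpty U → CornerAt i (shape U) →
          placeAt i (proj₂ (removeCorner d i U)) (proj₁ (removeCorner d i U)) ≡ U
  placeAt-removeCorner d zero ((a ∷ []) ∷ Us) (_ ∷ ns) c rewrite shorter-than-one Us ns c = refl
  placeAt-removeCorner d zero ((a ∷ b ∷ bs) ∷ Us) _ c = cong (_∷ Us) (splitLast-rejoin a (b ∷ bs))
  placeAt-removeCorner d (suc i) (R ∷ Us) (_ ∷ ns) c = cong (R ∷_) (placeAt-removeCorner d i Us ns c)

  unbumpRow-colBelow-bound : ∀ (v : Letter n) X Y → ColBelow X Y → All (v ≺_) Y → ColBelow (proj₁ (unbumpRow v X)) Y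
  unbumpRow-colBelow-bound v [] [] _ _ = tt
  unbumpRow-colBelow-bound v (a ∷ as) Y c al = go a as Y c al
    where
    go : ∀ a as Y → ColBelow (a ∷ as) Y → All (v ≺_) Y → ColBelow (proj₁ (unbumpRow∷ v a as)) Y
    go a [] [] _ _ = tt
    go a [] (y ∷ []) _ (p ∷ _) = p , tt
    go a (a2 ∷ as2) Y c al with int a2 <ᵇ int v
    go a (a2 ∷ as2) [] c al | true = tt
    go a (a2 ∷ as2) (y ∷ ys) (p , c) (_ ∷ al) | true = p , go a2 as2 ys c al
    go a (a2 ∷ as2) [] c al | false = tt
    go a (a2 ∷ as2) (y ∷ ys) (p , c) (q ∷ _) | false = q , c

  sorted-All≻ : ∀ (v b : Letter n) bs → v ≺ b → SortedRow (b ∷ bs) → All (v ≺_) (b ∷ bs)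
  sorted-All≻ v b bs p l = p ∷ All.map (<-≤-trans p) (sorted-head≼ l)

  unbumpRow-colBelow : ∀ (R : Row n) b bs y → SortedRow (b ∷ bs) → ColBelow R (b ∷ bs) → b ≺ y →
         ColBelow (proj₁ (unbumpRow (proj₂ (unbumpRow∷ y b bs)) R)) (proj₁ (unbumpRow∷ y b bs))
  unbumpRow-colBelow (a ∷ as) b [] y _ (ab , _) by = colBelow-singleton (proj₁ (unbumpRow∷ b a as)) y (unbumpRow-nonEmpty b a as)
                                          (unbumpRow-head (_≺ y) b a as (<-trans ab by) by)
  unbumpRow-colBelow (a ∷ as) b (b2 ∷ bs2) y (p ∷ l) (ab , c) by with int b2 <ᵇ int y in e
  unbumpRow-colBelow (a ∷ (a2 ∷ as2)) b (b2 ∷ bs2) y (p ∷ l) (ab , (a2b2 , c)) by | true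
    with int a2 <ᵇ int (proj₂ (unbumpRow∷ y b2 bs2)) in e2
  ... | true = ab , unbumpRow-colBelow (a2 ∷ as2) b2 bs2 y l (a2b2 , c) (<ᵇ≡true⇒< e)
  ... | false = ⊥-elim (<⇒≱ (<-≤-trans a2b2 (unbumpRow-head≼ y b2 bs2 l)) (<ᵇ≡false⇒≥ e2))
  unbumpRow-colBelow (a ∷ (a2 ∷ as2)) b (b2 ∷ bs2) y (p ∷ l) (ab , (a2b2 , c)) by | false with int a2 <ᵇ int b in e2
  ... | true = <-trans ab by ,
               unbumpRow-colBelow-bound b (a2 ∷ as2) (b2 ∷ bs2) (a2b2 , c) (sorted-All≻ b b2 bs2 (<-≤-trans by (<ᵇ≡false⇒≥ e)) l)
  ... | false = by , (a2b2 , c)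

  unbumpRow-colBelow-splitLast : ∀ (R : Row n) b bs → SortedRow (b ∷ bs) → ColBelow R (b ∷ bs) →
         ColBelow (proj₁ (unbumpRow (proj₂ (splitLast b bs)) R)) (proj₁ (splitLast b bs))
  unbumpRow-colBelow-splitLast R b [] _ _ = tt
  unbumpRow-colBelow-splitLast (a ∷ (a2 ∷ as2)) b (b2 ∷ bs2) (p ∷ l) (ab , (a2b2 , c)) with int a2 <ᵇ int (proj₂ (splitLast b2 bs2)) in e
  ... | true = ab , unbumpRow-colBelow-splitLast (a2 ∷ as2) b2 bs2 l (a2b2 , c)
  ... | false = ⊥-elim (<⇒≱ (<-≤-trans a2b2 (head≼splitLast b2 bs2 l)) (<ᵇ≡false⇒≥ e))

  dropLastCell-shape : ∀ d (R : Row n) Rs → shape (proj₁ (dropLastCell d R Rs)) ≡ removeCellFromPart (length R) (shape Rs)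
  dropLastCell-shape d [] Rs = refl
  dropLastCell-shape d (a ∷ []) Rs = refl
  dropLastCell-shape d (a ∷ b ∷ bs) Rs = cong (_∷ shape Rs) (cong suc (splitLast-length b bs))

  unbump-shape : ∀ d i (T : Tableau n) → shape (proj₁ (unbump d i T)) ≡ removeCell i (shape T)
  unbump-shape d _ [] = refl
  unbump-shape d zero (R ∷ Rs) = dropLastCell-shape d R Rs
  unbump-shape d (suc i) (R ∷ Rs) = cong₂ _∷_ (unbumpRow-length (proj₂ (unbump d i Rs)) R) (unbump-shape d i Rs)

  removeCorner-shape : ∀ d i (T : Tableau n) → shape (proj₁ (removeCorner d i T)) ≡ removeCell i (shape T)
  removeCorner-shape d _ [] = refl
  removeCorner-shape d zero (R ∷ Rs) = dropLastCell-shape d R Rs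
  removeCorner-shape d (suc i) (R ∷ Rs) = cong (length R ∷_) (removeCorner-shape d i Rs)

  UnbumpHeadInfo : Tableau n → Letter n → Tableau n → Set
  UnbumpHeadInfo [] x T0 = ⊤
  UnbumpHeadInfo (S ∷ Ss) x T0 = HeadSatisfies (_≼ x) S × (∀ R → SortedRow R → ColBelow R S → ColBelowHead (proj₁ (unbumpRow x R)) T0)

  insert-unbump : ∀ d i (T : Tableau n) → All NonEmpty T → RowsSorted T → Linked (ColBelow {n}) T → CornerAt i (shape T) →
    insert (proj₂ (unbump d i T)) (proj₁ (unbump d i T)) ≡ (T , i) × IsDottedSSYT (proj₁ (unbump d i T))
    × UnbumpHeadInfo T (proj₂ (unbump d i T)) (proj₁ (unbump d i T))
  insert-unbump d zero ((a ∷ []) ∷ Ss) (_ ∷ ns) _ _ c rewrite shorter-than-one Ss ns c =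
    refl , ([] , [] , []) , ≤-refl , (λ R _ _ → tt)
  insert-unbump d zero ((a ∷ b ∷ bs) ∷ Ss) (_ ∷ ns) (sS ∷ ss) l c =
    trans (insert-appended (proj₂ (splitLast a (b ∷ bs))) (proj₁ (splitLast a (b ∷ bs))) Ss
            (rowInsert-appends _ _ (splitLast-≼last a (b ∷ bs) sS)))
          (cong (λ r → (r ∷ Ss , 0)) (splitLast-rejoin a (b ∷ bs))) ,
    (tt ∷ ns , splitLast-sorted a (b ∷ bs) sS ∷ ss , columns-∷ (colBelowHead-init-upper a b bs Ss (columns-head l) c) (Linked.tail l)) ,
    head≼splitLast a (b ∷ bs) sS , (λ R _ cb → unbumpRow-colBelow-splitLast R a (b ∷ bs) sS cb)
  insert-unbump d (suc j) ((a ∷ as) ∷ []) _ _ _ ()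
  insert-unbump d (suc j) ((a ∷ as) ∷ (S2 ∷ Ss2)) (_ ∷ ns@(nS2 ∷ _)) (sS ∷ ss) l c
    with insert-unbump d j (S2 ∷ Ss2) ns ss (Linked.tail l) c
  ... | ins , (ne0 , s0 , l0) , hp , U2 =
    insert-bumped (proj₂ (unbumpRow∷ y a as)) (proj₁ (unbumpRow∷ y a as)) Ss0 (rowInsert-unbumpRow y a as sS ay) ins ,
    (unbumpRow-nonEmpty y a as ∷ ne0 , unbumpRow-sorted y a as sS ay ∷ s0 , columns-∷ (U2 (a ∷ as) sS (columns-head l)) l0) ,
    unbumpRow-head≼ y a as sS , (λ R sR cR → unbumpRow-colBelow R a as y sS cR ay)
    where
    y : Letter n
    y = proj₂ (unbump d j (S2 ∷ Ss2))
    Ss0 = proj₁ (unbump d j (S2 ∷ Ss2))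
    ay : a ≺ y
    ay = go S2 nS2 (columns-head l) hp
      where
      go : ∀ S → NonEmpty S → ColBelow (a ∷ as) S → HeadSatisfies (_≼ y) S → a ≺ y
      go (c ∷ cs) _ (p , _) q = <-≤-trans p q

  colBelow-init-lower : ∀ (R : Row n) b bs → ColBelow R (b ∷ bs) → ColBelow R (proj₁ (splitLast b bs))
  colBelow-init-lower R b [] _ = tt
  colBelow-init-lower (a ∷ as) b (b2 ∷ bs2) (ab , c) = ab , colBelow-init-lower as b2 bs2 c

  removeCorner-ssyt : ∀ d i (U : Tableau n) → IsDottedSSYT U → CornerAt i (shape U) → IsDottedSSYT (proj₁ (removeCorner d i U))
  removeCorner-ssyt d zero ((a ∷ []) ∷ Ss) (_ ∷ ns , _ , _) c rewrite shorter-than-one Ss ns c = [] , [] , []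
  removeCorner-ssyt d zero ((a ∷ b ∷ bs) ∷ Ss) (_ ∷ ns , sS ∷ ss , l) c =
    tt ∷ ns , splitLast-sorted a (b ∷ bs) sS ∷ ss , columns-∷ (colBelowHead-init-upper a b bs Ss (columns-head l) c) (Linked.tail l)
  removeCorner-ssyt d zero ([] ∷ Ss) (() ∷ _ , _) c
  removeCorner-ssyt d (suc i) (R ∷ []) _ ()
  removeCorner-ssyt d (suc i) (R ∷ S ∷ Ss) (nR ∷ ns , sR ∷ ss , l) c with removeCorner-ssyt d i (S ∷ Ss) (ns , ss , Linked.tail l) c
  ... | ne' , so' , co' = nR ∷ ne' , sR ∷ so' , columns-∷ (hc i S Ss ns c (columns-head l)) co'
    where
    hc : ∀ i S Ss → All NonEmpty (S ∷ Ss) → CornerAt i (shape (S ∷ Ss)) → ColBelow R S → ColBelowHead R (proj₁ (removeCorner d i (S ∷ Ss)))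
    hc zero (a ∷ []) Ss (_ ∷ ns) c _ rewrite shorter-than-one Ss ns c = tt
    hc zero (a ∷ b ∷ bs) Ss _ _ cb = colBelow-init-lower R a (b ∷ bs) cb
    hc zero [] Ss (() ∷ _) _ _
    hc (suc i) S Ss _ _ cb = cb

  placeAt≢[] : ∀ i (t : Letter n) U → placeAt i t U ≡ [] → ⊥
  placeAt≢[] _ t [] ()
  placeAt≢[] zero t (R ∷ Us) ()
  placeAt≢[] (suc i) t (R ∷ Us) ()

  ≼splitLast : ∀ (a : Letter n) as → SortedRow (a ∷ as) → All (_≼ proj₂ (splitLast a as)) (a ∷ as)
  ≼splitLast a [] _ = ≤-refl ∷ []
  ≼splitLast a (b ∷ bs) (p ∷ l) = head≼splitLast a (b ∷ bs) (p ∷ l) ∷ ≼splitLast b bs l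

  dropLastCell-last : ∀ d (a : Letter n) as Rs → proj₂ (dropLastCell d (a ∷ as) Rs) ≡ proj₂ (splitLast a as)
  dropLastCell-last d a [] Rs = refl
  dropLastCell-last d a (b ∷ bs) Rs = refl

  colBelow-corner : ∀ (a : Letter n) as S → ColBelow (a ∷ as) S → All (_≼ proj₂ (splitLast a as)) S → length S < suc (length as)
  colBelow-corner a as [] _ _ = s≤s z≤n
  colBelow-corner a [] (c ∷ cs) (p , _) (q ∷ _) = ⊥-elim (<⇒≱ p q)
  colBelow-corner a (b ∷ bs) (c ∷ cs) (_ , cb) (_ ∷ qs) = s≤s (colBelow-corner b bs cs cb qs)

  bounded-mono : ∀ {k m} (U : Tableau n) → k ≤ m → Bounded k U → Bounded m U
  bounded-mono U le = All.map (All.map (λ p → ≤-trans p le))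

  -- The end of the highest row that ends in a largest entry: where the last column was recorded.
  maximalCorner : ∀ d (U : Tableau n) → All NonEmpty U → RowsSorted U → Linked (ColBelow {n}) U → (U ≡ [] → ⊥) →
    Σ ℕ λ r → Σ (Letter n) λ t →
      proj₂ (removeCorner d r U) ≡ t × BoundedAbove (int t) r U × Bounded (int t) U × CornerAt r (shape U)
  maximalCorner d [] _ _ _ ne = ⊥-elim (ne refl)
  maximalCorner d ([] ∷ _) (() ∷ _) _ _ _
  maximalCorner d ((a ∷ as) ∷ []) _ (s ∷ _) _ _ =
    0 , proj₂ (splitLast a as) , dropLastCell-last d a as [] , tt , (≼splitLast a as s ∷ []) , s≤s z≤n
  maximalCorner d ((a ∷ as) ∷ (S ∷ Ss)) (_ ∷ ns) (s ∷ ss) l _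
    with maximalCorner d (S ∷ Ss) ns ss (Linked.tail l) (λ ())
  ... | r' , t' , eq' , top' , all' , cor' with int t' ≤? int (proj₂ (splitLast a as))
  ... | yes le = 0 , proj₂ (splitLast a as) , dropLastCell-last d a as (S ∷ Ss) , tt ,
                 (≼splitLast a as s ∷ bounded-mono (S ∷ Ss) le all') ,
                 colBelow-corner a as S (columns-head l) (hdAll all')
    where
    hdAll : Bounded (int t') (S ∷ Ss) → All (_≼ proj₂ (splitLast a as)) S
    hdAll (p ∷ _) = All.map (λ q → ≤-trans q le) p
  ... | no nle = suc r' , t' , eq' ,
                 (All.map (λ q → ≤-<-trans q lt) (≼splitLast a as s) , top') ,
                 (All.map (λ q → ≤-trans q (<⇒≤ lt)) (≼splitLast a as s) ∷ all') , cor'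
    where
    lt : int (proj₂ (splitLast a as)) < int t'
    lt = ≰⇒> nle

  SSYTPair : Tableau n × Tableau n → Set
  SSYTPair (T , U) = IsDottedSSYT T × IsDottedSSYT U × shape T ≡ shape U

  rskStep : Tableau n × Tableau n → Letter n × Letter n → Tableau n × Tableau n
  rskStep (T , U) (t , x) = proj₁ (insert x T) , placeAt (proj₂ (insert x T)) t U

  rskFrom-∷ʳ : ∀ (T U : Tableau n) β c → rskFrom T U (β ∷ʳ c) ≡ rskStep (rskFrom T U β) c
  rskFrom-∷ʳ T U [] (t , x) with insert x T
  ... | _ , _ = refl
  rskFrom-∷ʳ T U ((t , x) ∷ β) c with insert x T
  ... | T' , i = rskFrom-∷ʳ T' (placeAt i t U) β c

  dottedRSK-∷ʳ : ∀ β c → dottedRSK (β ∷ʳ c) ≡ rskStep (dottedRSK β) c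
  dottedRSK-∷ʳ = rskFrom-∷ʳ [] []

  dottedRSK-∷ʳ-recording≢[] : ∀ β c → proj₂ (dottedRSK (β ∷ʳ c)) ≡ [] → ⊥
  dottedRSK-∷ʳ-recording≢[] β c eq = placeAt≢[] _ _ _ (trans (sym (cong proj₂ (dottedRSK-∷ʳ β c))) eq)

  sameShape-length : ∀ {T U : Tableau n} → shape T ≡ shape U → length T ≡ length U
  sameShape-length {T} {U} sh = trans (sym (length-map length T)) (trans (cong length sh) (length-map length U))

  insert-row≤length : ∀ x (T : Tableau n) → proj₂ (insert x T) ≤ length T
  insert-row≤length x T = proj₂ (insert-shape x T refl)

  insert-ssyt : ∀ (x : Letter n) T {T' i} → IsDottedSSYT T → insert x T ≡ (T' , i) → IsDottedSSYT T'
  insert-ssyt x T (ne , so , co) e = insert-nonEmpty x T ne e , insert-rowsSorted x T so e , insert-columns x T co e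

  rskStep-ssytPair : ∀ {T U : Tableau n} t x → SSYTPair (T , U) →
                     Bounded (int t) U → BoundedAbove (int t) (proj₂ (insert x T)) U → SSYTPair (rskStep (T , U) (t , x))
  rskStep-ssytPair {T} {U} t x (sT , (neU , soU , coU) , sh) U≤t U<t =
    sT' , (placeAt-nonEmpty r t U neU , placeAt-rowsSorted r t U soU U≤t , placeAt-columns r t U neU coU U<t addable r≤) ,
    trans shT' (trans (cong (addCell r) sh) (sym (placeAt-shape r t U)))
    where
    r = proj₂ (insert x T)
    sT' = insert-ssyt x T sT refl
    shT' = proj₁ (insert-shape x T refl)
    r≤ : r ≤ length U
    r≤ = subst (r ≤_) (sameShape-length sh) (insert-row≤length x T)
    addable : AddableAt r (shape U)
    addable = addableAt-decreasing r (shape U)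
      (subst Decreasing (trans shT' (cong (addCell r) sh)) (shape-decreasing _ (proj₂ (proj₂ sT'))))
      (subst (r ≤_) (sym (length-map length U)) r≤)

  -- The letter t of the last column is a largest entry of the recording tableau, and the entries
  -- in the rows above its cell are smaller than t; this is what makes the last step reversible.
  record StepInvariant (t x : Letter n) (S : Tableau n × Tableau n) : Set where
    T₁ = proj₁ S
    U₁ = proj₂ S
    T = proj₁ (insert x T₁)
    r = proj₂ (insert x T₁)
    U = placeAt r t U₁
    field
      before : SSYTPair S
      after : SSYTPair (T , U)
      bounded : Bounded (int t) U
      boundedAbove : BoundedAbove (int t) r U
      weaklyAbove : ∀ x' → x ≼ x' → proj₂ (insert x' T) ≤ r
      row≤length : r ≤ length U₁

  lexLe⇒top≤ : ∀ {t₀ x₀ t x : Letter n} → LexLe (t₀ , x₀) (t , x) → int t₀ ≤ int t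
  lexLe⇒top≤ (inj₁ p) = <⇒≤ p
  lexLe⇒top≤ (inj₂ (e , _)) = ≤-reflexive e

  stepInvariant-extend : ∀ {t₀ x₀ t x S} → StepInvariant t₀ x₀ S → LexLe (t₀ , x₀) (t , x) →
                         StepInvariant t x (rskStep S (t₀ , x₀))
  stepInvariant-extend {t₀} {x₀} {t} {x} inv lex = record
    { before = after
    ; after = rskStep-ssytPair t x after U≤t U<t
    ; bounded = placeAt-bounded r′ t U U≤t ≤-refl
    ; boundedAbove = placeAt-boundedAbove r′ r′ t U ≤-refl r′≤ U<t
    ; weaklyAbove = λ x' x≼x' → insert-twice-weaklyAbove x x' T (proj₁ (proj₂ (proj₁ after))) x≼x' refl refl
    ; row≤length = r′≤
    }
    where
    open StepInvariant inv
    r′ = proj₂ (insert x T)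
    r′≤ : r′ ≤ length U
    r′≤ = subst (r′ ≤_) (sameShape-length (proj₂ (proj₂ after))) (insert-row≤length x T)
    U≤t : Bounded (int t) U
    U≤t = bounded-mono U (lexLe⇒top≤ {t₀} {x₀} {t} {x} lex) bounded
    U<t : BoundedAbove (int t) r′ U
    U<t = above lex
      where
      above : LexLe (t₀ , x₀) (t , x) → BoundedAbove (int t) r′ U
      above (inj₁ t₀<t) = bounded⇒boundedAbove r′ U bounded t₀<t
      above (inj₂ (t₀≡t , x₀≤x)) =
        subst (λ m → BoundedAbove m r′ U) t₀≡t (boundedAbove-mono r r′ U (weaklyAbove x x₀≤x) boundedAbove)

  stepInvariant : ∀ {β : Biword n} → Reverse β → ∀ {t x} → IsBiword (β ∷ʳ (t , x)) → StepInvariant t x (dottedRSK β)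
  stepInvariant [] {t} {x} _ = record
    { before = ([] , [] , []) , ([] , [] , []) , refl
    ; after = (tt ∷ [] , [-] ∷ [] , [-]) , (tt ∷ [] , [-] ∷ [] , [-]) , refl
    ; bounded = (≤-refl ∷ []) ∷ []
    ; boundedAbove = tt
    ; weaklyAbove = λ x' x≼x' → insert-twice-weaklyAbove x x' [] [] x≼x' refl refl
    ; row≤length = z≤n
    }
  stepInvariant (β ∶ rβ ∶ʳ c) {t} {x} bw =
    subst (StepInvariant t x) (sym (dottedRSK-∷ʳ β c))
      (stepInvariant-extend (stepInvariant rβ (linked-∷ʳ⁻ (β ∷ʳ c) bw)) (linked-∷ʳ-last β bw))

  dottedRSK-ssytPair : ∀ {β : Biword n} → Reverse β → IsBiword β → SSYTPair (dottedRSK β)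
  dottedRSK-ssytPair [] _ = ([] , [] , []) , ([] , [] , []) , refl
  dottedRSK-ssytPair (β ∶ rβ ∶ʳ c) bw =
    subst SSYTPair (sym (dottedRSK-∷ʳ β c)) (StepInvariant.after (stepInvariant rβ bw))

  recordingRow-≮ : ∀ {t t' : Letter n} {r r' U₁ U₁'} → r ≤ length U₁ → placeAt r t U₁ ≡ placeAt r' t' U₁' →
                   Bounded (int t) (placeAt r t U₁) → BoundedAbove (int t') r' (placeAt r' t' U₁') → ¬ r < r'
  recordingRow-≮ {t} {t'} {r} {r'} {U₁} {U₁'} r≤ eq U≤t U<t' r<r' =
    <⇒≱ (placeAt-boundedAbove-placed r' r t U₁ r<r' r≤ (subst (BoundedAbove (int t') r') (sym eq) U<t'))
        (proj₁ (placeAt-bounded⁻ r' t' U₁' (subst (Bounded (int t)) eq U≤t)))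

  rskStep-injective : ∀ {t x t' x' S S'} → StepInvariant t x S → StepInvariant t' x' S' →
                      rskStep S (t , x) ≡ rskStep S' (t' , x') → S ≡ S' × t ≡ t' × x ≡ x'
  rskStep-injective {t} {x} {t'} {x'} inv inv' eq =
    cong₂ _,_ (cong proj₁ T-eq) (cong proj₁ U-eq) , cong proj₂ U-eq , cong proj₂ T-eq
    where
    module I = StepInvariant inv
    module I' = StepInvariant inv'
    open ≡-Reasoning
    r≡r' : I.r ≡ I'.r
    r≡r' with <-cmp I.r I'.r
    ... | tri< r<r' _ _ = ⊥-elim (recordingRow-≮ I.row≤length (cong proj₂ eq) I.bounded I'.boundedAbove r<r')
    ... | tri≈ _ r≡r' _ = r≡r'
    ... | tri> _ _ r'<r = ⊥-elim (recordingRow-≮ I'.row≤length (sym (cong proj₂ eq)) I'.bounded I.boundedAbove r'<r)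
    nonEmpty : ∀ {S} → SSYTPair S → All NonEmpty (proj₁ S) × All NonEmpty (proj₂ S)
    nonEmpty ((neT , _) , (neU , _) , _) = neT , neU
    U-eq : (I.U₁ , t) ≡ (I'.U₁ , t')
    U-eq = begin
      I.U₁ , t                   ≡⟨ sym (removeCorner-placeAt x I.r t I.U₁ (proj₂ (nonEmpty I.before)) I.row≤length) ⟩
      removeCorner x I.r I.U     ≡⟨ cong₂ (removeCorner x) r≡r' (cong proj₂ eq) ⟩
      removeCorner x I'.r I'.U   ≡⟨ removeCorner-placeAt x I'.r t' I'.U₁ (proj₂ (nonEmpty I'.before)) I'.row≤length ⟩
      I'.U₁ , t'                 ∎
    T-eq : (I.T₁ , x) ≡ (I'.T₁ , x')
    T-eq = begin
      I.T₁ , x                   ≡⟨ sym (unbump-insert x x I.T₁ (proj₁ (proj₂ (proj₁ I.before))) (proj₁ (nonEmpty I.before)) refl) ⟩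
      unbump x I.r I.T           ≡⟨ cong₂ (unbump x) r≡r' (cong proj₁ eq) ⟩
      unbump x I'.r I'.T         ≡⟨ unbump-insert x x' I'.T₁ (proj₁ (proj₂ (proj₁ I'.before))) (proj₁ (nonEmpty I'.before)) refl ⟩
      I'.T₁ , x'                 ∎

  dottedRSK-injective : ∀ {β β' : Biword n} → Reverse β → Reverse β' → IsBiword β → IsBiword β' →
                        dottedRSK β ≡ dottedRSK β' → β ≡ β'
  dottedRSK-injective [] [] _ _ _ = refl
  dottedRSK-injective [] (β' ∶ _ ∶ʳ c') _ _ eq = ⊥-elim (dottedRSK-∷ʳ-recording≢[] β' c' (sym (cong proj₂ eq)))
  dottedRSK-injective (β ∶ _ ∶ʳ c) [] _ _ eq = ⊥-elim (dottedRSK-∷ʳ-recording≢[] β c (cong proj₂ eq))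
  dottedRSK-injective (β ∶ rβ ∶ʳ c) (β' ∶ rβ' ∶ʳ c') bw bw' eq =
    let S≡S' , t≡t' , x≡x' = rskStep-injective (stepInvariant rβ bw) (stepInvariant rβ' bw')
                               (trans (sym (dottedRSK-∷ʳ β c)) (trans eq (dottedRSK-∷ʳ β' c')))
    in cong₂ _∷ʳ_ (dottedRSK-injective rβ rβ' (linked-∷ʳ⁻ β bw) (linked-∷ʳ⁻ β' bw') S≡S') (cong₂ _,_ t≡t' x≡x')

  record LastStep (T U : Tableau n) : Set where
    field
      T₀ U₀ : Tableau n
      t x : Letter n
      r : ℕ
      ssytPair : SSYTPair (T₀ , U₀)
      inserted : insert x T₀ ≡ (T , r)
      placed : placeAt r t U₀ ≡ U
      bounded : Bounded (int t) U
      boundedAbove : BoundedAbove (int t) r U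

  lastStep : ∀ (d : Letter n) {T U} → SSYTPair (T , U) → (U ≡ [] → ⊥) → LastStep T U
  lastStep d {T} {U} ((neT , soT , coT) , sU@(neU , soU , coU) , sh) U≢[]
    with maximalCorner d U neU soU coU U≢[]
  ... | r , t , t≡ , U<t , U≤t , corner = record
    { T₀ = proj₁ (unbump d r T)
    ; U₀ = proj₁ (removeCorner d r U)
    ; t = t
    ; x = proj₂ (unbump d r T)
    ; r = r
    ; ssytPair = proj₁ (proj₂ unbumped) ,
                 removeCorner-ssyt d r U sU corner ,
                 trans (unbump-shape d r T) (trans (cong (removeCell r) sh) (sym (removeCorner-shape d r U)))
    ; inserted = proj₁ unbumped
    ; placed = subst (λ s → placeAt r s (proj₁ (removeCorner d r U)) ≡ U) t≡ (placeAt-removeCorner d r U neU corner)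
    ; bounded = U≤t
    ; boundedAbove = U<t
    }
    where
    unbumped = insert-unbump d r T neT soT coT (subst (CornerAt r) (sym sh) corner)

  lastStep-lexLe : ∀ {t₀ x₀ S T U} → StepInvariant t₀ x₀ S → (ls : LastStep T U) →
                   rskStep S (t₀ , x₀) ≡ (LastStep.T₀ ls , LastStep.U₀ ls) → LexLe (t₀ , x₀) (LastStep.t ls , LastStep.x ls)
  lastStep-lexLe {t₀} {x₀} inv ls eq = lexLe (m≤n⇒m<n∨m≡n t₀≤t)
    where
    open LastStep ls
    open StepInvariant inv using (T₁; U₁; before; row≤length) renaming (r to r₀)
    t₀≤t : int t₀ ≤ int t
    t₀≤t = proj₁ (placeAt-bounded⁻ r₀ t₀ U₁ (subst (Bounded (int t)) (sym (cong proj₂ eq))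
             (proj₂ (placeAt-bounded⁻ r t U₀ (subst (Bounded (int t)) (sym placed) bounded)))))
    x≺x₀⇒t₀<t : x ≺ x₀ → int t₀ < int t
    x≺x₀⇒t₀<t x≺x₀ = placeAt-boundedAbove-placed r r₀ t₀ U₁ r₀<r row≤length
      (subst (BoundedAbove (int t) r) (sym (cong proj₂ eq))
        (placeAt-boundedAbove⁻ r r t U₀ ≤-refl (subst (BoundedAbove (int t) r) (sym placed) boundedAbove)))
      where
      r₀<r : r₀ < r
      r₀<r = insert-twice-strictlyBelow x₀ x T₁ (proj₁ (proj₂ (proj₁ before))) x≺x₀ (cong (_, r₀) (cong proj₁ eq)) inserted
    lexLe : int t₀ < int t ⊎ int t₀ ≡ int t → LexLe (t₀ , x₀) (t , x)
    lexLe (inj₁ t₀<t) = inj₁ t₀<t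
    lexLe (inj₂ t₀≡t) with int x₀ ≤? int x
    ... | yes x₀≤x = inj₂ (t₀≡t , x₀≤x)
    ... | no x₀≰x = ⊥-elim (<-irrefl t₀≡t (x≺x₀⇒t₀<t (≰⇒> x₀≰x)))

  biword-∷ʳ-lastStep : ∀ {β : Biword n} {T U} → Reverse β → IsBiword β → (ls : LastStep T U) →
                       dottedRSK β ≡ (LastStep.T₀ ls , LastStep.U₀ ls) → IsBiword (β ∷ʳ (LastStep.t ls , LastStep.x ls))
  biword-∷ʳ-lastStep [] _ _ _ = [-]
  biword-∷ʳ-lastStep (β ∶ rβ ∶ʳ c) bw ls eq =
    linked-∷ʳ⁺ β bw (lastStep-lexLe (stepInvariant rβ bw) ls (trans (sym (dottedRSK-∷ʳ β c)) eq))

  dottedRSK-surjective : ∀ N {T U : Tableau n} → sum (shape U) ≡ N → SSYTPair (T , U) →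
                         Σ (Biword n) λ β → IsBiword β × dottedRSK β ≡ (T , U)
  dottedRSK-surjective N {[]} {[]} _ _ = [] , [] , refl
  dottedRSK-surjective N {_ ∷ _} {[]} _ (_ , _ , ())
  dottedRSK-surjective N {U = [] ∷ _} _ (_ , (() ∷ _ , _) , _)
  dottedRSK-surjective N {T} {U@((d ∷ _) ∷ _)} size≡ pair = go N size≡
    where
    ls = lastStep d pair (λ ())
    open LastStep ls
    size₀ : sum (shape U) ≡ suc (sum (shape U₀))
    size₀ = trans (cong (λ V → sum (shape V)) (sym placed))
              (trans (cong sum (placeAt-shape r t U₀)) (sum-addCell r (shape U₀)))
    go : ∀ N → sum (shape U) ≡ N → Σ (Biword n) λ β → IsBiword β × dottedRSK β ≡ (T , U)
    go zero size≡ = ⊥-elim (0≢1+n (trans (sym size≡) size₀))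
    go (suc N) size≡ with dottedRSK-surjective N (suc-injective (trans (sym size₀) size≡)) ssytPair
    ... | β₀ , bw₀ , eq₀ = β₀ ∷ʳ (t , x) , biword-∷ʳ-lastStep (reverseView β₀) bw₀ ls eq₀ , (begin
      dottedRSK (β₀ ∷ʳ (t , x))         ≡⟨ dottedRSK-∷ʳ β₀ (t , x) ⟩
      rskStep (dottedRSK β₀) (t , x)    ≡⟨ cong (λ S → rskStep S (t , x)) eq₀ ⟩
      rskStep (T₀ , U₀) (t , x)         ≡⟨ cong (λ p → proj₁ p , placeAt (proj₂ p) t U₀) inserted ⟩
      T , placeAt r t U₀                ≡⟨ cong (T ,_) placed ⟩
      T , U                             ∎)
      where open ≡-Reasoning

  -- Multidegrees

  rowInsert-↭ : ∀ (x : Letter n) r {r' z} → rowInsert x r ≡ bumped r' z → z ∷ r' ↭ x ∷ r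
  rowInsert-↭ x [] ()
  rowInsert-↭ x (y ∷ ys) eq with int x <ᵇ int y
  rowInsert-↭ x (y ∷ ys) refl | true = ↭.swap y x ↭.refl
  ... | false with rowInsert x ys in e
  rowInsert-↭ x (y ∷ ys) () | false | appended _
  rowInsert-↭ x (y ∷ ys) refl | false | bumped ys' z =
    ↭.trans (↭.swap z y ↭.refl) (↭.trans (↭.prep y (rowInsert-↭ x ys e)) (↭.swap y x ↭.refl))

  insert-↭ : ∀ (x : Letter n) T {T' i} → insert x T ≡ (T' , i) → concat T' ↭ x ∷ concat T
  insert-↭ x [] refl = ↭.refl
  insert-↭ x (r ∷ rs) eq with rowInsert x r in e
  insert-↭ x (r ∷ rs) refl | appended r' with rowInsert-appended x r e
  ... | refl , _ = ++⁺ʳ↭ (concat rs) (↭-sym (∷↭∷ʳ x r))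
  insert-↭ x (r ∷ rs) eq | bumped r' z with insert z rs in e'
  insert-↭ x (r ∷ rs) refl | bumped r' z | rs' , _ = begin
    r' ++ concat rs'        ↭⟨ ++⁺ˡ↭ r' (insert-↭ z rs e') ⟩
    r' ++ z ∷ concat rs     ↭⟨ shift z r' (concat rs) ⟩
    z ∷ r' ++ concat rs     ↭⟨ ++⁺ʳ↭ (concat rs) (rowInsert-↭ x r e) ⟩
    x ∷ r ++ concat rs      ∎
    where open PermutationReasoning

  placeAt-↭ : ∀ i (t : Letter n) U → concat (placeAt i t U) ↭ t ∷ concat U
  placeAt-↭ _ t [] = ↭.refl
  placeAt-↭ zero t (R ∷ Us) = ++⁺ʳ↭ (concat Us) (↭-sym (∷↭∷ʳ t R))
  placeAt-↭ (suc i) t (R ∷ Us) = ↭.trans (++⁺ˡ↭ R (placeAt-↭ i t Us)) (shift t R (concat Us))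

  dottedRSK-↭ : ∀ {β : Biword n} → Reverse β →
                concat (proj₁ (dottedRSK β)) ↭ lower β × concat (proj₂ (dottedRSK β)) ↭ upper β
  dottedRSK-↭ [] = ↭.refl , ↭.refl
  dottedRSK-↭ (β ∶ rβ ∶ʳ (t , x)) = insertion , recording
    where
    open PermutationReasoning
    T = proj₁ (dottedRSK β)
    U = proj₂ (dottedRSK β)
    insertion : concat (proj₁ (dottedRSK (β ∷ʳ (t , x)))) ↭ lower (β ∷ʳ (t , x))
    insertion = begin
      concat (proj₁ (dottedRSK (β ∷ʳ (t , x))))  ≡⟨ cong (λ S → concat (proj₁ S)) (dottedRSK-∷ʳ β (t , x)) ⟩
      concat (proj₁ (insert x T))                ↭⟨ insert-↭ x T refl ⟩
      x ∷ concat T                               <⟨ proj₁ (dottedRSK-↭ rβ) ⟩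
      x ∷ lower β                                ↭⟨ ∷↭∷ʳ x (lower β) ⟩
      lower β ∷ʳ x                               ≡⟨ sym (map-++ proj₂ β _) ⟩
      lower (β ∷ʳ (t , x))                       ∎
    recording : concat (proj₂ (dottedRSK (β ∷ʳ (t , x)))) ↭ upper (β ∷ʳ (t , x))
    recording = begin
      concat (proj₂ (dottedRSK (β ∷ʳ (t , x))))  ≡⟨ cong (λ S → concat (proj₂ S)) (dottedRSK-∷ʳ β (t , x)) ⟩
      concat (placeAt _ t U)                     ↭⟨ placeAt-↭ _ t U ⟩
      t ∷ concat U                               <⟨ proj₂ (dottedRSK-↭ rβ) ⟩
      t ∷ upper β                                ↭⟨ ∷↭∷ʳ t (upper β) ⟩
      upper β ∷ʳ t                               ≡⟨ sym (map-++ proj₁ β _) ⟩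
      upper (β ∷ʳ (t , x))                       ∎

  dotCount : Fin n → Letter n → ℕ
  dotCount k a with dots a ≟ᶠ k
  ... | yes _ = 1
  ... | no _ = 0

  countDots-∷ : ∀ k (a : Letter n) as → countDots k (a ∷ as) ≡ dotCount k a + countDots k as
  countDots-∷ k a as with dots a ≟ᶠ k
  ... | yes _ = refl
  ... | no _ = refl

  countDots-∷-cong : ∀ k (a : Letter n) {xs ys} → countDots k xs ≡ countDots k ys → countDots k (a ∷ xs) ≡ countDots k (a ∷ ys)
  countDots-∷-cong k a eq with dots a ≟ᶠ k
  ... | yes _ = cong suc eq
  ... | no _ = eq

  countDots-swap : ∀ k (x y : Letter n) zs → countDots k (x ∷ y ∷ zs) ≡ countDots k (y ∷ x ∷ zs)
  countDots-swap k x y zs = begin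
    countDots k (x ∷ y ∷ zs)                          ≡⟨ countDots-∷ k x (y ∷ zs) ⟩
    dotCount k x + countDots k (y ∷ zs)                ≡⟨ cong (dotCount k x +_) (countDots-∷ k y zs) ⟩
    dotCount k x + (dotCount k y + countDots k zs)     ≡⟨ x∙yz≈y∙xz (dotCount k x) (dotCount k y) (countDots k zs) ⟩
    dotCount k y + (dotCount k x + countDots k zs)     ≡⟨ cong (dotCount k y +_) (countDots-∷ k x zs) ⟨
    dotCount k y + countDots k (x ∷ zs)                ≡⟨ countDots-∷ k y (x ∷ zs) ⟨
    countDots k (y ∷ x ∷ zs)                          ∎
    where open ≡-Reasoning

  countDots-↭ : ∀ k {xs ys : List (Letter n)} → xs ↭ ys → countDots k xs ≡ countDots k ys
  countDots-↭ k ↭.refl = refl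
  countDots-↭ k (↭.prep x p) = countDots-∷-cong k x (countDots-↭ k p)
  countDots-↭ k (↭.swap x y p) =
    trans (countDots-swap k x y _) (countDots-∷-cong k y (countDots-∷-cong k x (countDots-↭ k p)))
  countDots-↭ k (↭.trans p q) = trans (countDots-↭ k p) (countDots-↭ k q)

  mdeg-↭ : ∀ {xs ys : List (Letter n)} → xs ↭ ys → mdeg xs ≡ mdeg ys
  mdeg-↭ {xs} {ys} p = tabulate-cong {f = λ k → countDots k xs} {g = λ k → countDots k ys} (λ k → countDots-↭ k p)

  dottedRSK-mdeg : ∀ β → mdegBiword β ≡ (mdegTableau (proj₁ (dottedRSK β)) , mdegTableau (proj₂ (dottedRSK β)))
  dottedRSK-mdeg β = cong₂ _,_ (sym (mdeg-↭ T↭lower)) (sym (mdeg-↭ U↭upper))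
    where
    T↭lower : concat (proj₁ (dottedRSK β)) ↭ lower β
    T↭lower = proj₁ (dottedRSK-↭ (reverseView β))
    U↭upper : concat (proj₂ (dottedRSK β)) ↭ upper β
    U↭upper = proj₂ (dottedRSK-↭ (reverseView β))

theorem8p1 : (n : ℕ) → 1 ≤ n →
    -- well-defined: lands in pairs of dotted SSYT of the same shape
    ((β : Biword n) → IsBiword β →
      IsDottedSSYT (proj₁ (dottedRSK β)) × IsDottedSSYT (proj₂ (dottedRSK β))
        × shape (proj₁ (dottedRSK β)) ≡ shape (proj₂ (dottedRSK β)))
    -- injective on biwords
    × ((β β' : Biword n) → IsBiword β → IsBiword β' →
        dottedRSK β ≡ dottedRSK β' → β ≡ β')
    -- surjective onto pairs of dotted SSYT of the same shape
    × ((T U : Tableau n) → IsDottedSSYT T → IsDottedSSYT U → shape T ≡ shape U →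
        Σ (Biword n) (λ β → IsBiword β × dottedRSK β ≡ (T , U)))
    -- multidegree preservation
    × ((β : Biword n) → IsBiword β →
        mdegBiword β ≡ (mdegTableau (proj₁ (dottedRSK β)) , mdegTableau (proj₂ (dottedRSK β))))
theorem8p1 n _ =
    (λ β bw → dottedRSK-ssytPair (reverseView β) bw)
  , (λ β β' bw bw' → dottedRSK-injective (reverseView β) (reverseView β') bw bw')
  , (λ T U sT sU sh → dottedRSK-surjective (sum (shape U)) refl (sT , sU , sh))
  , (λ β _ → dottedRSK-mdeg β)
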